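{- Let $T$ be a rooted tree with $n$ leaves and write $$\Gamma_T(x)=\det(xI-C(T))=\sum_{k=0}^n(-1)^k\gamma_k(T)x^{n-k}.$$ Then for each $k\in\{0,1,\ldots,n\}$, $\gamma_k(T)$ equals the number of edge-disjoint collections of upward paths of $T$ in which exactly $k$ of the paths are non-trivial. Consequently, $$\det(I+C(T))=(-1)^n\Gamma_T(-1)=\sum_{k=0}^n\gamma_k(T)$$ is the total number of edge-disjoint collections of upward paths of $T$.
   Context: A rooted tree $T$ has a distinguished vertex $r$, the root; the level $\ell(v)$ of a vertex $v$ is its distance from $r$. A leaf is a vertex without children (the root counts as a leaf only if it is the only vertex). For vertices $v,w$, $v\vee w$ denotes the common ancestor of $v$ and $w$ farthest from the root (every vertex is an ancestor of itself). If $v_1,\ldots,v_n$ are the leaves, the ancestral matrix $C(T)$ is the $n\times n$ matrix with $(i,j)$ entry $\ell(v_i\vee v_j)$. An upward path from a leaf is a path starting at that leaf and moving only towards the root; it may be trivial (consisting of the leaf alone, with no edges). A collection of upward paths consists of one upward path starting at each leaf of $T$; it is edge-disjoint if no two of its paths share an edge (they may share vertices). -}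

module Defs where

open import Data.Nat as ℕ using (ℕ; zero; suc; _∸_; _≤ᵇ_; _<ᵇ_; _≡ᵇ_)
open import Data.Integer as ℤ using (ℤ; +_)
open import Data.Bool using (Bool; true; false; _∧_; _∨_; not; if_then_else_)
open import Data.List as List using (List; []; _∷_; length; map; concat; filter; take; allFin; upTo; foldr; lookup)
open import Data.Bool.ListAction using (and; or)
open import Data.List.Relation.Unary.All using ()
open import Data.Fin as Fin using (Fin; toℕ)
open import Data.Fin.Base using (punchIn)
open import Relation.Nullary.Decidable using (does)
open import Data.Bool.Properties using (T?)

-- Every finite rooted tree is isomorphic
-- to such a term (the order of children is irrelevant for the theorem).

data RTree : Set where
  node : List RTree → RTree

-- Vertices are addressed by the list of child indices on the path from
-- the root; the root is [] and the level of a vertex is the length of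
-- its address.  The child endpoint of an edge identifies the edge.
Vertex : Set
Vertex = List ℕ

level : Vertex → ℕ
level = length

-- addresses of the leaves (vertices without children); the root is a
-- leaf iff it is the only vertex.
mutual
  leaves : RTree → List Vertex
  leaves (node []) = [] ∷ []
  leaves (node (t ∷ ts)) = leavesFrom 0 (t ∷ ts)

  leavesFrom : ℕ → List RTree → List Vertex
  leavesFrom i [] = []
  leavesFrom i (t ∷ ts) = map (i ∷_) (leaves t) List.++ leavesFrom (suc i) ts

numLeaves : RTree → ℕ
numLeaves T = length (leaves T)

leaf : (T : RTree) → Fin (numLeaves T) → Vertex
leaf T i = lookup (leaves T) i

-- v ∨ w : the deepest common ancestor (ancestors = prefixes of addresses)
_∨v_ : Vertex → Vertex → Vertex
[] ∨v w = []
(x ∷ v) ∨v [] = []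
(x ∷ v) ∨v (y ∷ w) = if does (x ℕ.≟ y) then x ∷ (v ∨v w) else []

C : (T : RTree) → Fin (numLeaves T) → Fin (numLeaves T) → ℤ
C T i j = + level (leaf T i ∨v leaf T j)

module Det {A : Set} (_+_ _*_ : A → A → A) (-_ : A → A) (0# 1# : A) where

  sgn : ℕ → A → A
  sgn zero a = a
  sgn (suc k) a = - sgn k a

  sumFin : ∀ {n} → (Fin n → A) → A
  sumFin {zero} f = 0#
  sumFin {suc n} f = f Fin.zero + sumFin (λ i → f (Fin.suc i))

  det : ∀ {n} → (Fin n → Fin n → A) → A
  det {zero} M = 1#
  det {suc n} M =
    sumFin (λ j → sgn (toℕ j) (M Fin.zero j * det (λ r c → M (Fin.suc r) (punchIn j c))))

-- Integer polynomials as coefficient lists (lowest degree first).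

Poly : Set
Poly = List ℤ

_+P_ : Poly → Poly → Poly
[] +P q = q
(a ∷ p) +P [] = a ∷ p
(a ∷ p) +P (b ∷ q) = (a ℤ.+ b) ∷ (p +P q)

scaleP : ℤ → Poly → Poly
scaleP a = map (a ℤ.*_)

_*P_ : Poly → Poly → Poly
[] *P q = []
(a ∷ p) *P q = scaleP a q +P (ℤ.0ℤ ∷ (p *P q))

-P_ : Poly → Poly
-P_ = map (λ a → ℤ.- a)

constP : ℤ → Poly
constP a = a ∷ []

X : Poly
X = ℤ.0ℤ ∷ ℤ.1ℤ ∷ []

coeff : ℕ → Poly → ℤ
coeff k [] = ℤ.0ℤ
coeff zero (a ∷ p) = a
coeff (suc k) (a ∷ p) = coeff k p

module DetP = Det _+P_ _*P_ -P_ [] (constP ℤ.1ℤ)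
module DetZ = Det ℤ._+_ ℤ._*_ (λ a → ℤ.- a) ℤ.0ℤ ℤ.1ℤ

δ : ∀ {n} → Fin n → Fin n → Bool
δ i j = does (i Fin.≟ j)

Γ : RTree → Poly
Γ T = DetP.det (λ i j → (if δ i j then X else []) +P (-P constP (C T i j)))

IplusC : (T : RTree) → Fin (numLeaves T) → Fin (numLeaves T) → ℤ
IplusC T i j = (if δ i j then ℤ.1ℤ else ℤ.0ℤ) ℤ.+ C T i j

-- An upward path from a leaf v is determined by its
-- number of edges m, with 0 ≤ m ≤ level v.  Its edges are the edges
-- whose child endpoint is the ancestor of v at level p, for
-- level v − m < p ≤ level v; that ancestor is  take p v.

edgesOfPath : Vertex → ℕ → List Vertex
edgesOfPath v m = map (λ p → take p v)
                      (filter (λ p → (level v ∸ m) ℕ.<? p) (upTo (suc (level v))))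

_==v_ : Vertex → Vertex → Bool
[] ==v [] = true
[] ==v (_ ∷ _) = false
(_ ∷ _) ==v [] = false
(x ∷ v) ==v (y ∷ w) = does (x ℕ.≟ y) ∧ (v ==v w)

shareEdge : List Vertex → List Vertex → Bool
shareEdge es fs = or (map (λ e → or (map (e ==v_) fs)) es)

-- A collection of upward paths: one length per leaf (in leaf order).
-- All collections: lists (m_i) with 0 ≤ m_i ≤ level(v_i).
collectionsFor : List Vertex → List (List ℕ)
collectionsFor [] = [] ∷ []
collectionsFor (v ∷ vs) =
  concat (map (λ m → map (m ∷_) (collectionsFor vs)) (upTo (suc (level v))))

collections : RTree → List (List ℕ)
collections T = collectionsFor (leaves T)

pathsOf : List Vertex → List ℕ → List (List Vertex)
pathsOf (v ∷ vs) (m ∷ ms) = edgesOfPath v m ∷ pathsOf vs ms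
pathsOf _ _ = []

pairwiseDisjoint : List (List Vertex) → Bool
pairwiseDisjoint [] = true
pairwiseDisjoint (e ∷ es) = and (map (λ f → not (shareEdge e f)) es) ∧ pairwiseDisjoint es

edgeDisjoint : RTree → List ℕ → Bool
edgeDisjoint T ms = pairwiseDisjoint (pathsOf (leaves T) ms)

numNonTrivial : List ℕ → ℕ
numNonTrivial [] = 0
numNonTrivial (zero ∷ ms) = numNonTrivial ms
numNonTrivial (suc _ ∷ ms) = suc (numNonTrivial ms)

countK : RTree → ℕ → ℕ
countK T k = length (filter (λ ms → T? (edgeDisjoint T ms ∧ (numNonTrivial ms ≡ᵇ k)))
                            (collections T))

countAll : RTree → ℕ
countAll T = length (filter (λ ms → T? (edgeDisjoint T ms)) (collections T))

-- Both are specialisations of one identity, proved over an arbitrary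
-- commutative ring: for every finite family V of vertices (repetitions
-- allowed) and all x, y,
--     det (x·I + y·C(V)) = Σ over edge-disjoint collections of upward paths
--                           from V of x^(#trivial paths) · y^(#non-trivial paths).
-- Both sides obey the same three reduction rules at a deepest vertex v of V:
-- v is the root; no other member lies below v (move v to its parent); or v
-- occurs twice (inclusion–exclusion).
module Submission where

open import Algebra.Bundles using (CommutativeRing)
open import Level using (0ℓ)

module BooleanEquality where

  open import Data.Nat using (_≡ᵇ_)
  import Data.Nat.Properties as ℕP
  open import Data.Bool using (true; false)
  open import Data.Bool.Properties using (T-≡)
  open import Function.Bundles using (Equivalence)
  open import Data.Empty using (⊥; ⊥-elim)
  open import Relation.Binary.PropositionalEquality

  ≡ᵇ-sound : ∀ {x y} → (x ≡ᵇ y) ≡ true → x ≡ y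
  ≡ᵇ-sound {x} {y} eq = ℕP.≡ᵇ⇒≡ x y (Equivalence.from T-≡ eq)

  ≡ᵇ-complete : ∀ {x y} → x ≡ y → (x ≡ᵇ y) ≡ true
  ≡ᵇ-complete {x} {y} eq = Equivalence.to T-≡ (ℕP.≡⇒≡ᵇ x y eq)

  ≡ᵇ-false : ∀ {x y} → (x ≡ y → ⊥) → (x ≡ᵇ y) ≡ false
  ≡ᵇ-false {x} {y} x≢y with x ≡ᵇ y in xy
  ... | true = ⊥-elim (x≢y (≡ᵇ-sound xy))
  ... | false = refl

  ≡ᵇ-cong : ∀ {a b c d} → (a ≡ b → c ≡ d) → (c ≡ d → a ≡ b) → (a ≡ᵇ b) ≡ (c ≡ᵇ d)
  ≡ᵇ-cong {a} {b} {c} {d} to from with a ≡ᵇ b in ab | c ≡ᵇ d in cd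
  ... | true | true = refl
  ... | false | false = refl
  ... | true | false with () ← trans (sym (≡ᵇ-complete (to (≡ᵇ-sound ab)))) cd
  ... | false | true with () ← trans (sym (≡ᵇ-complete (from (≡ᵇ-sound cd)))) ab

  ≡ᵇ-refl : ∀ x → (x ≡ᵇ x) ≡ true
  ≡ᵇ-refl x = ≡ᵇ-complete {x} refl

  ≡ᵇ-comm : ∀ x y → (x ≡ᵇ y) ≡ (y ≡ᵇ x)
  ≡ᵇ-comm x y = ≡ᵇ-cong {x} {y} sym sym

module Ancestry where

  open import Defs
  open import Data.Nat as ℕ using (zero; suc; _≤_)
  open import Data.List using ([]; _∷_; length; take)
  open import Data.List.Properties using (take-all)
  import Data.List.Properties as LP
  import Data.Nat.Properties as ℕP
  open import Data.Bool using (true; false)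
  open import Data.Empty using (⊥-elim)
  open import Relation.Nullary using (¬_; Dec)
  open import Relation.Binary.PropositionalEquality
  open BooleanEquality

  _≼_ : Vertex → Vertex → Set
  u ≼ w = take (length u) w ≡ u

  _≼?_ : ∀ u w → Dec (u ≼ w)
  u ≼? w = LP.≡-dec ℕP._≟_ (take (length u) w) u

  ≼-deepest : ∀ {u w} → u ≼ w → length w ≤ length u → w ≡ u
  ≼-deepest {u} {w} u≼w le = trans (sym (take-all (length u) w le)) u≼w

  -- the parent of a non-root vertex (the root is its own parent)
  parent : Vertex → Vertex
  parent [] = []
  parent (a ∷ []) = []
  parent (a ∷ b ∷ u) = a ∷ parent (b ∷ u)

  level-parent : ∀ a u → level (a ∷ u) ≡ suc (level (parent (a ∷ u)))
  level-parent a [] = refl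
  level-parent a (b ∷ u) = cong suc (level-parent b u)

  take-parent : ∀ q a u → q ≤ length u → take q (a ∷ u) ≡ take q (parent (a ∷ u))
  take-parent zero a u le = refl
  take-parent (suc q) a (b ∷ u) (ℕ.s≤s le) = cong (a ∷_) (take-parent q b u le)

  ∨v-comm : ∀ u w → u ∨v w ≡ w ∨v u
  ∨v-comm [] [] = refl
  ∨v-comm [] (y ∷ w) = refl
  ∨v-comm (x ∷ u) [] = refl
  ∨v-comm (x ∷ u) (y ∷ w) rewrite ≡ᵇ-comm y x with x ℕ.≡ᵇ y in eq
  ... | true with refl ← ≡ᵇ-sound {x} {y} eq = cong (x ∷_) (∨v-comm u w)
  ... | false = refl

  ∨v-idem : ∀ u → u ∨v u ≡ u
  ∨v-idem [] = refl
  ∨v-idem (x ∷ u) rewrite ≡ᵇ-refl x = cong (x ∷_) (∨v-idem u)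

  -- if v is not an ancestor of w, then v ∨ w is an ancestor of the parent
  -- of v, so moving v to its parent does not change the meet with w
  ∨v-parentˡ : ∀ a u w → ¬ (a ∷ u) ≼ w → level ((a ∷ u) ∨v w) ≡ level (parent (a ∷ u) ∨v w)
  ∨v-parentˡ a [] [] _ = refl
  ∨v-parentˡ a [] (c ∷ w) v⋠w with a ℕ.≡ᵇ c in eq
  ... | true with refl ← ≡ᵇ-sound {a} {c} eq = ⊥-elim (v⋠w refl)
  ... | false = refl
  ∨v-parentˡ a (b ∷ u) [] _ = refl
  ∨v-parentˡ a (b ∷ u) (c ∷ w) v⋠w with a ℕ.≡ᵇ c in eq
  ... | true with refl ← ≡ᵇ-sound {a} {c} eq =
    cong suc (∨v-parentˡ b u w (λ u≼w → v⋠w (cong (a ∷_) u≼w)))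
  ... | false = refl

  ∨v-parentʳ : ∀ a u w → ¬ (a ∷ u) ≼ w → level (w ∨v (a ∷ u)) ≡ level (w ∨v parent (a ∷ u))
  ∨v-parentʳ a u w v⋠w rewrite ∨v-comm w (a ∷ u) | ∨v-comm w (parent (a ∷ u)) = ∨v-parentˡ a u w v⋠w

  ==v-refl : ∀ u → (u ==v u) ≡ true
  ==v-refl [] = refl
  ==v-refl (x ∷ u) rewrite ≡ᵇ-refl x = ==v-refl u

  ==v-sound : ∀ u w → (u ==v w) ≡ true → u ≡ w
  ==v-sound [] [] _ = refl
  ==v-sound (x ∷ u) (y ∷ w) eq with x ℕ.≡ᵇ y in eqxy
  ... | true with refl ← ≡ᵇ-sound {x} {y} eqxy = cong (x ∷_) (==v-sound u w eq)

  ==v-comm : ∀ u w → (u ==v w) ≡ (w ==v u)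
  ==v-comm [] [] = refl
  ==v-comm [] (y ∷ w) = refl
  ==v-comm (x ∷ u) [] = refl
  ==v-comm (x ∷ u) (y ∷ w) rewrite ≡ᵇ-comm x y | ==v-comm u w = refl

  take-==v-non-ancestor : ∀ u w j → ¬ u ≼ w → (take j w ==v u) ≡ false
  take-==v-non-ancestor u w j u⋠w with take j w ==v u in eq
  ... | false = refl
  ... | true = ⊥-elim (u⋠w (subst (λ z → take (length z) w ≡ z) (==v-sound _ _ eq) (take-take j w)))
    where
    take-take : ∀ j (w : Vertex) → take (length (take j w)) w ≡ take j w
    take-take zero w = refl
    take-take (suc j) [] = refl
    take-take (suc j) (x ∷ w) = cong (x ∷_) (take-take j w)

module UpwardPaths where

  open import Defs
  open Ancestry
  open import Data.Nat as ℕ using (suc; _∸_)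
  import Data.Nat.Properties as ℕP
  open import Data.List using (List; []; _∷_; length; take; map; filter; upTo; _++_)
  import Data.List.Properties as LP
  import Data.List.Relation.Unary.All.Properties as AllP
  open import Data.Bool using (Bool; true; false; _∧_; _∨_; not)
  import Data.Bool.Properties as BP
  open import Data.Bool.ListAction using (and; or; any)
  open import Relation.Binary.PropositionalEquality
  open import Function using (id)

  any-++ : ∀ {X : Set} (p : X → Bool) xs ys → any p (xs ++ ys) ≡ any p xs ∨ any p ys
  any-++ p [] ys = refl
  any-++ p (x ∷ xs) ys rewrite any-++ p xs ys = sym (BP.∨-assoc (p x) (any p xs) (any p ys))

  any-∨ : ∀ {X : Set} (p q : X → Bool) xs → any (λ z → p z ∨ q z) xs ≡ any p xs ∨ any q xs
  any-∨ p q [] = refl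
  any-∨ p q (x ∷ xs) rewrite any-∨ p q xs = ∨-interchange (p x) (q x) (any p xs) (any q xs)
    where
    ∨-interchange : ∀ a b c d → (a ∨ b) ∨ (c ∨ d) ≡ (a ∨ c) ∨ (b ∨ d)
    ∨-interchange false b c d =
      trans (sym (BP.∨-assoc b c d)) (trans (cong (_∨ d) (BP.∨-comm b c)) (BP.∨-assoc c b d))
    ∨-interchange true b c d = refl

  any-false : ∀ {X : Set} (xs : List X) → any (λ _ → false) xs ≡ false
  any-false [] = refl
  any-false (x ∷ xs) = any-false xs

  any-cong : ∀ {X : Set} {p q : X → Bool} xs → (∀ z → p z ≡ q z) → any p xs ≡ any q xs
  any-cong xs p≗q = cong or (LP.map-cong p≗q xs)

  mem : Vertex → List Vertex → Bool
  mem e E = any (e ==v_) E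

  mem-++ : ∀ e E F → mem e (E ++ F) ≡ mem e E ∨ mem e F
  mem-++ e = any-++ (e ==v_)

  mem-last : ∀ e E → mem e (E ++ e ∷ []) ≡ true
  mem-last e E rewrite mem-++ e E (e ∷ []) | ==v-refl e = BP.∨-zeroʳ (mem e E)

  shareEdge-++ˡ : ∀ P Q E → shareEdge (P ++ Q) E ≡ shareEdge P E ∨ shareEdge Q E
  shareEdge-++ˡ P Q E = any-++ (λ e → mem e E) P Q

  shareEdge-++ʳ : ∀ P E F → shareEdge P (E ++ F) ≡ shareEdge P E ∨ shareEdge P F
  shareEdge-++ʳ P E F = trans (any-cong P (λ e → mem-++ e E F)) (any-∨ (λ e → mem e E) (λ e → mem e F) P)

  shareEdge-[]ʳ : ∀ P → shareEdge P [] ≡ false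
  shareEdge-[]ʳ = any-false

  shareEdge-comm : ∀ P Q → shareEdge P Q ≡ shareEdge Q P
  shareEdge-comm [] Q = sym (any-false Q)
  shareEdge-comm (e ∷ P) Q = trans (cong (mem e Q ∨_) (shareEdge-comm P Q))
    (sym (trans (any-cong Q (λ f → cong (_∨ mem f P) (==v-comm f e))) (any-∨ (e ==v_) (λ f → mem f P) Q)))

  shareEdge-path-cong : ∀ v m E F → (∀ j → mem (take j v) E ≡ mem (take j v) F) →
    shareEdge (edgesOfPath v m) E ≡ shareEdge (edgesOfPath v m) F
  shareEdge-path-cong v m E F E≈F =
    trans (sym (cong or (LP.map-∘ ps))) (trans (any-cong ps E≈F) (cong or (LP.map-∘ ps)))
    where ps = filter (λ p → (level v ∸ m) ℕ.<? p) (upTo (suc (level v)))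

  edgesOfPath-trivial : ∀ v → edgesOfPath v 0 ≡ []
  edgesOfPath-trivial v = cong (map (λ p → take p v)) (LP.filter-none (λ p → level v ℕ.<? p)
     (AllP.applyUpTo⁺₁ id (suc (level v)) (λ i<n → ℕP.≤⇒≯ (ℕP.≤-pred i<n))))

  edgesOfPath-step : ∀ a u m →
    edgesOfPath (a ∷ u) (suc m) ≡ edgesOfPath (parent (a ∷ u)) m ++ (a ∷ u) ∷ []
  edgesOfPath-step a u m = begin
    map take-v (filter P? (upTo (suc (suc ℓ))))
      ≡⟨ cong (λ z → map take-v (filter P? z)) (sym (LP.upTo-∷ʳ (suc ℓ))) ⟩
    map take-v (filter P? (upTo (suc ℓ) ++ suc ℓ ∷ []))
      ≡⟨ cong (map take-v) (LP.filter-++ P? (upTo (suc ℓ)) (suc ℓ ∷ [])) ⟩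
    map take-v (filter P? (upTo (suc ℓ)) ++ filter P? (suc ℓ ∷ []))
      ≡⟨ cong (λ z → map take-v (filter P? (upTo (suc ℓ)) ++ z)) (LP.filter-accept P? (ℕ.s≤s (ℕP.m∸n≤m ℓ m))) ⟩
    map take-v (filter P? (upTo (suc ℓ)) ++ suc ℓ ∷ [])
      ≡⟨ LP.map-++ take-v (filter P? (upTo (suc ℓ))) (suc ℓ ∷ []) ⟩
    map take-v (filter P? (upTo (suc ℓ))) ++ take (suc ℓ) v ∷ []
      ≡⟨ cong₂ (λ z w → z ++ w ∷ []) (LP.map-cong-local (AllP.filter⁺ P? (AllP.applyUpTo⁺₁ id (suc ℓ)
            (λ {i} i<n → take-parent i a u (ℕP.≤-pred i<n))))) (cong (a ∷_) (LP.take-all ℓ u ℕP.≤-refl)) ⟩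
    map (λ p → take p (parent v)) (filter P? (upTo (suc ℓ))) ++ v ∷ []
      ≡⟨ cong (λ k → map (λ p → take p (parent v)) (filter (λ p → (k ∸ m) ℕ.<? p) (upTo (suc k))) ++ v ∷ [])
              (sym level-parent′) ⟩
    edgesOfPath (parent v) m ++ v ∷ [] ∎
    where
    open ≡-Reasoning
    v = a ∷ u
    ℓ = length u
    take-v = λ p → take p v
    P? = λ p → (ℓ ∸ m) ℕ.<? p
    level-parent′ : level (parent v) ≡ ℓ
    level-parent′ = ℕP.suc-injective (sym (level-parent a u))

  -- two non-trivial paths from the same leaf share the edge above it
  nontrivial-paths-share : ∀ a u m m′ E →
    shareEdge (edgesOfPath (a ∷ u) (suc m)) (edgesOfPath (a ∷ u) (suc m′) ++ E) ≡ true
  nontrivial-paths-share a u m m′ E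
    rewrite edgesOfPath-step a u m | edgesOfPath-step a u m′
          | shareEdge-++ˡ (edgesOfPath (parent (a ∷ u)) m) ((a ∷ u) ∷ []) ((edgesOfPath (parent (a ∷ u)) m′ ++ (a ∷ u) ∷ []) ++ E)
          | mem-++ (a ∷ u) (edgesOfPath (parent (a ∷ u)) m′ ++ (a ∷ u) ∷ []) E
          | mem-last (a ∷ u) (edgesOfPath (parent (a ∷ u)) m′) = BP.∨-zeroʳ _

  avoids : List (List Vertex) → List Vertex → Bool
  avoids Ps E = and (map (λ P → not (shareEdge P E)) Ps)

  avoids-[] : ∀ Ps → avoids Ps [] ≡ true
  avoids-[] [] = refl
  avoids-[] (P ∷ Ps) rewrite shareEdge-[]ʳ P = avoids-[] Ps

  avoids-++ : ∀ Ps P E → avoids Ps (P ++ E) ≡ and (map (λ Q → not (shareEdge P Q)) Ps) ∧ avoids Ps E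
  avoids-++ [] P E = refl
  avoids-++ (Q ∷ Ps) P E rewrite avoids-++ Ps P E | shareEdge-++ʳ Q P E | shareEdge-comm Q P =
    ∧-interchange (shareEdge P Q) (shareEdge Q E) _ _
    where
    ∧-interchange : ∀ a b c d → not (a ∨ b) ∧ (c ∧ d) ≡ (not a ∧ c) ∧ (not b ∧ d)
    ∧-interchange false false c d = refl
    ∧-interchange false true c d = sym (BP.∧-zeroʳ c)
    ∧-interchange true b c d = refl

  disjoint-both : ∀ P Q E →
    (not (shareEdge P E) ∧ not (shareEdge Q (P ++ E))) ≡ (not (shareEdge Q E) ∧ not (shareEdge P (Q ++ E)))
  disjoint-both P Q E
    rewrite shareEdge-++ʳ Q P E | shareEdge-++ʳ P Q E | shareEdge-comm Q P =
    not-∨-swap (shareEdge P E) (shareEdge P Q) (shareEdge Q E)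
    where
    not-∨-swap : ∀ a b c → (not a ∧ not (b ∨ c)) ≡ (not c ∧ not (b ∨ a))
    not-∨-swap false false false = refl
    not-∨-swap false false true = refl
    not-∨-swap false true c = sym (BP.∧-zeroʳ (not c))
    not-∨-swap true b false = cong not (sym (BP.∨-zeroʳ b))
    not-∨-swap true b true = refl

  mem-swap : ∀ e P Q E → mem e (Q ++ P ++ E) ≡ mem e (P ++ Q ++ E)
  mem-swap e P Q E rewrite mem-++ e Q (P ++ E) | mem-++ e P (Q ++ E) | mem-++ e P E | mem-++ e Q E =
    trans (sym (BP.∨-assoc (mem e Q) _ _)) (trans (cong (_∨ mem e E) (BP.∨-comm (mem e Q) _)) (BP.∨-assoc (mem e P) _ _))

  disjoint-cons : ∀ P Ps E →
    (not (shareEdge P E) ∧ (pairwiseDisjoint Ps ∧ avoids Ps (P ++ E))) ≡ (pairwiseDisjoint (P ∷ Ps) ∧ avoids (P ∷ Ps) E)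
  disjoint-cons P Ps E rewrite avoids-++ Ps P E =
    shuffle (not (shareEdge P E)) (pairwiseDisjoint Ps) (and (map (λ Q → not (shareEdge P Q)) Ps)) (avoids Ps E)
    where
    shuffle : ∀ a b c d → (a ∧ (b ∧ (c ∧ d))) ≡ ((c ∧ b) ∧ (a ∧ d))
    shuffle false b c d = sym (BP.∧-zeroʳ (c ∧ b))
    shuffle true true true d = refl
    shuffle true true false d = refl
    shuffle true false true d = refl
    shuffle true false false d = refl

module Indicator (R : CommutativeRing 0ℓ 0ℓ) where

  open import Data.Bool using (Bool; true; false; if_then_else_; _∧_)
  open CommutativeRing R renaming (Carrier to A)

  ind : Bool → A → A
  ind b a = if b then a else 0#

  ind-cong : ∀ b {a c} → a ≈ c → ind b a ≈ ind b c
  ind-cong true a≈c = a≈c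
  ind-cong false _ = refl

  ind-unit : ∀ b a → ind b a ≈ a * ind b 1#
  ind-unit true a = sym (*-identityʳ a)
  ind-unit false a = sym (zeroʳ a)

  ind-∧ : ∀ b₁ b₂ c d → ind b₁ (c * ind b₂ d) ≈ ind (b₁ ∧ b₂) (c * d)
  ind-∧ true true c d = refl
  ind-∧ true false c d = zeroʳ c
  ind-∧ false b₂ c d = refl

module Determinant (R : CommutativeRing 0ℓ 0ℓ) where

  open import Data.Nat as ℕ using (ℕ; zero; suc)
  import Data.Nat.Properties as ℕP
  open import Data.Fin as Fin using (Fin; toℕ; punchIn)
  open import Data.Bool using (true; false; if_then_else_)
  open import Relation.Binary.PropositionalEquality as P using (_≡_)
  open import Function using (_∘_)

  open CommutativeRing R renaming (Carrier to A)
  open import Algebra.Properties.Ring ring using (-‿distribʳ-*; -‿involutive; -0#≈0#)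
  open import Algebra.Properties.AbelianGroup +-abelianGroup using (⁻¹-∙-comm)
  open import Algebra.Properties.Group +-group using (inverseˡ-unique)
  open import Algebra.Properties.Semiring.Sum semiring using (sum; sum-cong-≋; ∑-distrib-+; sum-remove; *-distribˡ-sum)
  import Algebra.Properties.CommutativeSemigroup
  private
    module *-Comm = Algebra.Properties.CommutativeSemigroup *-commutativeSemigroup
  open import Relation.Binary.Reasoning.Setoid setoid

  open import Defs using (module Det; δ)
  open Det _+_ _*_ -_ 0# 1# public
  open Indicator R

  sgn-cong : ∀ k {a b} → a ≈ b → sgn k a ≈ sgn k b
  sgn-cong zero a≈b = a≈b
  sgn-cong (suc k) a≈b = -‿cong (sgn-cong k a≈b)

  sgn-≡ : ∀ {m n} a → m ≡ n → sgn m a ≈ sgn n a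
  sgn-≡ a P.refl = refl

  sgn-+ℕ : ∀ m n a → sgn (m ℕ.+ n) a ≈ sgn m (sgn n a)
  sgn-+ℕ zero n a = refl
  sgn-+ℕ (suc m) n a = -‿cong (sgn-+ℕ m n a)

  sgn-*ʳ : ∀ k a b → sgn k (a * b) ≈ a * sgn k b
  sgn-*ʳ zero a b = refl
  sgn-*ʳ (suc k) a b = trans (-‿cong (sgn-*ʳ k a b)) (-‿distribʳ-* a (sgn k b))

  sgn-+ : ∀ k a b → sgn k (a + b) ≈ sgn k a + sgn k b
  sgn-+ zero a b = refl
  sgn-+ (suc k) a b = trans (-‿cong (sgn-+ k a b)) (sym (⁻¹-∙-comm (sgn k a) (sgn k b)))

  sgn-neg : ∀ k a → sgn k (- a) ≈ - sgn k a
  sgn-neg zero a = refl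
  sgn-neg (suc k) a = -‿cong (sgn-neg k a)

  sgn-0 : ∀ k → sgn k 0# ≈ 0#
  sgn-0 zero = refl
  sgn-0 (suc k) = trans (-‿cong (sgn-0 k)) -0#≈0#

  sgn-ss : ∀ k a → sgn (suc (suc k)) a ≈ sgn k a
  sgn-ss k a = -‿involutive (sgn k a)

  sgn-even : ∀ k a → sgn (k ℕ.+ k) a ≈ a
  sgn-even zero a = refl
  sgn-even (suc k) a = begin
    sgn (suc k ℕ.+ suc k) a      ≈⟨ sgn-≡ a (P.cong suc (ℕP.+-suc k k)) ⟩
    sgn (suc (suc (k ℕ.+ k))) a  ≈⟨ sgn-ss (k ℕ.+ k) a ⟩
    sgn (k ℕ.+ k) a              ≈⟨ sgn-even k a ⟩
    a                            ∎

  sumFin≈sum : ∀ {n} (f : Fin n → A) → sumFin f ≈ sum f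
  sumFin≈sum {zero} f = refl
  sumFin≈sum {suc n} f = +-congˡ (sumFin≈sum (f ∘ Fin.suc))

  sumFin-cong : ∀ {n} {f g : Fin n → A} → (∀ i → f i ≈ g i) → sumFin f ≈ sumFin g
  sumFin-cong {f = f} {g} f≈g = trans (sumFin≈sum f) (trans (sum-cong-≋ f≈g) (sym (sumFin≈sum g)))

  sumFin-0 : ∀ {n} {f : Fin n → A} → (∀ i → f i ≈ 0#) → sumFin f ≈ 0#
  sumFin-0 {zero} f≈0 = refl
  sumFin-0 {suc n} f≈0 = trans (+-cong (f≈0 Fin.zero) (sumFin-0 (f≈0 ∘ Fin.suc))) (+-identityˡ 0#)

  sumFin-+ : ∀ {n} (f g : Fin n → A) → sumFin (λ i → f i + g i) ≈ sumFin f + sumFin g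
  sumFin-+ f g = trans (sumFin≈sum (λ i → f i + g i)) (trans (∑-distrib-+ f g) (sym (+-cong (sumFin≈sum f) (sumFin≈sum g))))

  sumFin-*ˡ : ∀ {n} a (f : Fin n → A) → a * sumFin f ≈ sumFin (λ i → a * f i)
  sumFin-*ˡ a f = trans (*-congˡ (sumFin≈sum f)) (trans (*-distribˡ-sum a f) (sym (sumFin≈sum (λ i → a * f i))))

  sumFin-split : ∀ {n} (k : Fin (suc n)) (f : Fin (suc n) → A) →
                 sumFin f ≈ f k + sumFin (f ∘ punchIn k)
  sumFin-split k f = trans (sumFin≈sum f) (trans (sum-remove {i = k} f) (+-congˡ (sym (sumFin≈sum (f ∘ punchIn k)))))

  sumFin-sgn : ∀ {n} k (f : Fin n → A) → sgn k (sumFin f) ≈ sumFin (λ i → sgn k (f i))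
  sumFin-sgn {zero} k f = sgn-0 k
  sumFin-sgn {suc n} k f = trans (sgn-+ k _ _) (+-congˡ (sumFin-sgn k (f ∘ Fin.suc)))

  Mat : ℕ → Set
  Mat n = Fin n → Fin n → A

  minor : ∀ {n} → Mat (suc n) → Fin (suc n) → Fin (suc n) → Mat n
  minor M r c i j = M (punchIn r i) (punchIn c j)

  δ-refl : ∀ {n} (i : Fin n) → δ i i ≡ true
  δ-refl Fin.zero = P.refl
  δ-refl (Fin.suc i) = δ-refl i

  δ-sound : ∀ {n} (i j : Fin n) → δ i j ≡ true → i ≡ j
  δ-sound Fin.zero Fin.zero _ = P.refl
  δ-sound (Fin.suc i) (Fin.suc j) eq = P.cong Fin.suc (δ-sound i j eq)

  δ-punchIn : ∀ {n} (k : Fin (suc n)) i j → δ (punchIn k i) (punchIn k j) ≡ δ i j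
  δ-punchIn Fin.zero i j = P.refl
  δ-punchIn (Fin.suc k) Fin.zero Fin.zero = P.refl
  δ-punchIn (Fin.suc k) Fin.zero (Fin.suc j) = P.refl
  δ-punchIn (Fin.suc k) (Fin.suc i) Fin.zero = P.refl
  δ-punchIn (Fin.suc k) (Fin.suc i) (Fin.suc j) = δ-punchIn k i j

  δ-punchInˡ : ∀ {n} (k : Fin (suc n)) i → δ (punchIn k i) k ≡ false
  δ-punchInˡ Fin.zero i = P.refl
  δ-punchInˡ (Fin.suc k) Fin.zero = P.refl
  δ-punchInˡ (Fin.suc k) (Fin.suc i) = δ-punchInˡ k i

  δ-punchInʳ : ∀ {n} (k : Fin (suc n)) i → δ k (punchIn k i) ≡ false
  δ-punchInʳ Fin.zero i = P.refl
  δ-punchInʳ (Fin.suc k) Fin.zero = P.refl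
  δ-punchInʳ (Fin.suc k) (Fin.suc i) = δ-punchInʳ k i

  data View {n} (k : Fin (suc n)) : Fin (suc n) → Set where
    here : View k k
    there : ∀ i → View k (punchIn k i)

  view : ∀ {n} (k j : Fin (suc n)) → View k j
  view Fin.zero Fin.zero = here
  view Fin.zero (Fin.suc j) = there j
  view {suc n} (Fin.suc k) Fin.zero = there Fin.zero
  view {suc n} (Fin.suc k) (Fin.suc j) with view k j
  ... | here = here
  ... | there i = there (Fin.suc i)

  e : ∀ {n} → Fin n → Fin n → A
  e c j = ind (δ c j) 1#

  e-diag : ∀ {n} (k : Fin n) → e k k ≡ 1#
  e-diag k = P.cong (λ b → ind b 1#) (δ-refl k)

  e-off : ∀ {n} (k : Fin (suc n)) i → e k (punchIn k i) ≡ 0#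
  e-off k i = P.cong (λ b → ind b 1#) (δ-punchInʳ k i)

  e-punchIn : ∀ {n} (k : Fin (suc n)) i j → e (punchIn k i) (punchIn k j) ≡ e i j
  e-punchIn k i j = P.cong (λ b → ind b 1#) (δ-punchIn k i j)

  at : ∀ {n} {f g : Fin n → A} → f ≡ g → ∀ j → f j ≈ g j
  at P.refl j = refl

  det-cong : ∀ {n} {M N : Mat n} → (∀ i j → M i j ≈ N i j) → det M ≈ det N
  det-cong {zero} _ = refl
  det-cong {suc n} M≈N = sumFin-cong (λ j → sgn-cong (toℕ j)
    (*-cong (M≈N Fin.zero j) (det-cong (λ a b → M≈N (Fin.suc a) (punchIn j b)))))

  laplaceTerm : ∀ {n} → Mat (suc n) → Fin (suc n) → A
  laplaceTerm M j = sgn (toℕ j) (M Fin.zero j * det (minor M Fin.zero j))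

  det-combination : ∀ {n} (M B C : Mat (suc n)) a b →
    (∀ j → M Fin.zero j * det (minor M Fin.zero j) ≈
           a * (B Fin.zero j * det (minor B Fin.zero j)) + b * (C Fin.zero j * det (minor C Fin.zero j))) →
    det M ≈ a * det B + b * det C
  det-combination M B C a b termwise = begin
    sumFin (laplaceTerm M)
      ≈⟨ sumFin-cong (λ j → trans (sgn-cong (toℕ j) (termwise j)) (sgn-linear (toℕ j))) ⟩
    sumFin (λ j → a * laplaceTerm B j + b * laplaceTerm C j)
      ≈⟨ sumFin-+ (λ j → a * laplaceTerm B j) (λ j → b * laplaceTerm C j) ⟩
    sumFin (λ j → a * laplaceTerm B j) + sumFin (λ j → b * laplaceTerm C j)
      ≈⟨ sym (+-cong (sumFin-*ˡ a (laplaceTerm B)) (sumFin-*ˡ b (laplaceTerm C))) ⟩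
    a * det B + b * det C ∎
    where
    sgn-linear : ∀ k {X Y} → sgn k (a * X + b * Y) ≈ a * sgn k X + b * sgn k Y
    sgn-linear k = trans (sgn-+ k _ _) (+-cong (sgn-*ʳ k a _) (sgn-*ʳ k b _))

  linear : ∀ {n} (M B C : Mat (suc n)) r a b →
    (∀ i j → M (punchIn r i) j ≈ B (punchIn r i) j) →
    (∀ i j → M (punchIn r i) j ≈ C (punchIn r i) j) →
    (∀ j → M r j ≈ a * B r j + b * C r j) →
    det M ≈ a * det B + b * det C
  linear M B C Fin.zero a b M≈B M≈C row = det-combination M B C a b λ j → begin
    M Fin.zero j * det (minor M Fin.zero j)
      ≈⟨ *-cong (row j) refl ⟩
    (a * B Fin.zero j + b * C Fin.zero j) * det (minor M Fin.zero j)
      ≈⟨ distribʳ _ _ _ ⟩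
    a * B Fin.zero j * det (minor M Fin.zero j) + b * C Fin.zero j * det (minor M Fin.zero j)
      ≈⟨ +-cong (trans (*-assoc _ _ _) (*-congˡ (*-congˡ (det-cong (λ p q → M≈B p (punchIn j q))))))
                (trans (*-assoc _ _ _) (*-congˡ (*-congˡ (det-cong (λ p q → M≈C p (punchIn j q)))))) ⟩
    a * (B Fin.zero j * det (minor B Fin.zero j)) + b * (C Fin.zero j * det (minor C Fin.zero j)) ∎
  linear {suc n} M B C (Fin.suc r) a b M≈B M≈C row = det-combination M B C a b λ j → begin
    M Fin.zero j * det (minor M Fin.zero j)
      ≈⟨ *-congˡ (linear (minor M Fin.zero j) (minor B Fin.zero j) (minor C Fin.zero j) r a b
           (λ p q → M≈B (Fin.suc p) (punchIn j q)) (λ p q → M≈C (Fin.suc p) (punchIn j q)) (row ∘ punchIn j)) ⟩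
    M Fin.zero j * (a * det (minor B Fin.zero j) + b * det (minor C Fin.zero j))
      ≈⟨ distribˡ _ _ _ ⟩
    M Fin.zero j * (a * det (minor B Fin.zero j)) + M Fin.zero j * (b * det (minor C Fin.zero j))
      ≈⟨ +-cong (trans (*-Comm.x∙yz≈y∙xz _ _ _) (*-congˡ (*-congʳ (M≈B Fin.zero j))))
                (trans (*-Comm.x∙yz≈y∙xz _ _ _) (*-congˡ (*-congʳ (M≈C Fin.zero j)))) ⟩
    a * (B Fin.zero j * det (minor B Fin.zero j)) + b * (C Fin.zero j * det (minor C Fin.zero j)) ∎

  zeroRow : ∀ {n} (M : Mat (suc n)) r → (∀ j → M r j ≈ 0#) → det M ≈ 0#
  zeroRow M r row≈0 = begin
    det M                    ≈⟨ linear M M M r 0# 0# (λ _ _ → refl) (λ _ _ → refl) (λ j → trans (row≈0 j) (sym 0·+0·≈0)) ⟩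
    0# * det M + 0# * det M  ≈⟨ 0·+0·≈0 ⟩
    0#                       ∎
    where
    0·+0·≈0 : ∀ {a b} → 0# * a + 0# * b ≈ 0#
    0·+0·≈0 = trans (+-cong (zeroˡ _) (zeroˡ _)) (+-identityˡ 0#)

  -- Expanding twice, along column j and then along column c of the minor,
  -- picks the pair of columns {j, punchIn j c}; `partner j c` is the index
  -- that picks the same pair in the opposite order.
  partner : ∀ {n} → Fin (suc (suc n)) → Fin (suc n) → Fin (suc n)
  partner Fin.zero c = Fin.zero
  partner (Fin.suc j) Fin.zero = j
  partner {suc n} (Fin.suc j) (Fin.suc c) = Fin.suc (partner j c)

  partner-back : ∀ {n} (j : Fin (suc (suc n))) c → punchIn (punchIn j c) (partner j c) ≡ j
  partner-back Fin.zero c = P.refl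
  partner-back (Fin.suc j) Fin.zero = P.refl
  partner-back {suc n} (Fin.suc j) (Fin.suc c) = P.cong Fin.suc (partner-back j c)

  partner-avoids : ∀ {n} (j : Fin (suc (suc n))) c i → δ (punchIn (punchIn j c) (punchIn (partner j c) i)) j ≡ false
  partner-avoids j c i = P.trans (P.cong (δ (punchIn (punchIn j c) (punchIn (partner j c) i))) (P.sym (partner-back j c)))
                           (P.trans (δ-punchIn (punchIn j c) (punchIn (partner j c) i) (partner j c)) (δ-punchInˡ (partner j c) i))

  partner-columns : ∀ {n} (j : Fin (suc (suc n))) c (b : Fin n) →
    punchIn j (punchIn c b) ≡ punchIn (punchIn j c) (punchIn (partner j c) b)
  partner-columns Fin.zero c b = P.refl
  partner-columns (Fin.suc j) Fin.zero b = P.refl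
  partner-columns {suc n} (Fin.suc j) (Fin.suc c) Fin.zero = P.refl
  partner-columns {suc n} (Fin.suc j) (Fin.suc c) (Fin.suc b) = P.cong Fin.suc (partner-columns j c b)

  partner-sgn : ∀ {n} (j : Fin (suc (suc n))) c a →
    sgn (toℕ (punchIn j c) ℕ.+ toℕ (partner j c)) a ≈ - sgn (toℕ j ℕ.+ toℕ c) a
  partner-sgn Fin.zero c a = -‿cong (sgn-≡ a (ℕP.+-identityʳ (toℕ c)))
  partner-sgn (Fin.suc j) Fin.zero a = begin
    sgn (toℕ j) a              ≈⟨ sym (sgn-ss (toℕ j) a) ⟩
    - - sgn (toℕ j) a          ≈⟨ -‿cong (-‿cong (sgn-≡ a (P.sym (ℕP.+-identityʳ (toℕ j))))) ⟩
    - - sgn (toℕ j ℕ.+ 0) a    ∎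
  partner-sgn {suc n} (Fin.suc j) (Fin.suc c) a = begin
    sgn (suc (toℕ (punchIn j c)) ℕ.+ suc (toℕ (partner j c))) a
      ≈⟨ sgn-≡ a (P.cong suc (ℕP.+-suc (toℕ (punchIn j c)) (toℕ (partner j c)))) ⟩
    sgn (suc (suc (toℕ (punchIn j c) ℕ.+ toℕ (partner j c)))) a
      ≈⟨ sgn-ss (toℕ (punchIn j c) ℕ.+ toℕ (partner j c)) a ⟩
    sgn (toℕ (punchIn j c) ℕ.+ toℕ (partner j c)) a
      ≈⟨ partner-sgn j c a ⟩
    - sgn (toℕ j ℕ.+ toℕ c) a
      ≈⟨ -‿cong (sym (sgn-ss (toℕ j ℕ.+ toℕ c) a)) ⟩
    - sgn (suc (suc (toℕ j ℕ.+ toℕ c))) a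
      ≈⟨ -‿cong (sgn-≡ a (P.cong suc (P.sym (ℕP.+-suc (toℕ j) (toℕ c))))) ⟩
    - sgn (suc (toℕ j) ℕ.+ suc (toℕ c)) a ∎

  unitRow-sgn : ∀ {n} (c : Fin (suc (suc n))) i r a →
    sgn (toℕ (punchIn c i)) (sgn (r ℕ.+ toℕ (partner c i)) a) ≈ sgn (suc r ℕ.+ toℕ c) (sgn (toℕ i) a)
  unitRow-sgn c i r a = begin
    sgn pc (sgn (r ℕ.+ s) a)          ≈⟨ sym (sgn-+ℕ pc (r ℕ.+ s) a) ⟩
    sgn (pc ℕ.+ (r ℕ.+ s)) a          ≈⟨ sgn-≡ a (ℕ+-Comm.x∙yz≈y∙xz pc r s) ⟩
    sgn (r ℕ.+ (pc ℕ.+ s)) a          ≈⟨ sgn-+ℕ r (pc ℕ.+ s) a ⟩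
    sgn r (sgn (pc ℕ.+ s) a)          ≈⟨ sgn-cong r (partner-sgn c i a) ⟩
    sgn r (sgn (suc (toℕ c ℕ.+ toℕ i)) a)  ≈⟨ sym (sgn-+ℕ r (suc (toℕ c ℕ.+ toℕ i)) a) ⟩
    sgn (r ℕ.+ suc (toℕ c ℕ.+ toℕ i)) a    ≈⟨ sgn-≡ a (P.trans (ℕP.+-suc r (toℕ c ℕ.+ toℕ i))
                                                 (P.cong suc (P.sym (ℕP.+-assoc r (toℕ c) (toℕ i))))) ⟩
    sgn ((suc r ℕ.+ toℕ c) ℕ.+ toℕ i) a    ≈⟨ sgn-+ℕ (suc r ℕ.+ toℕ c) (toℕ i) a ⟩
    sgn (suc r ℕ.+ toℕ c) (sgn (toℕ i) a)  ∎
    where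
    pc = toℕ (punchIn c i)
    s = toℕ (partner c i)
    module ℕ+-Comm = Algebra.Properties.CommutativeSemigroup ℕP.+-commutativeSemigroup

  det-unitRow : ∀ {n} (M : Mat (suc n)) r c → (∀ j → M r j ≈ e c j) →
                det M ≈ sgn (toℕ r ℕ.+ toℕ c) (det (minor M r c))
  det-unitRow M Fin.zero c row = begin
    sumFin (laplaceTerm M)
      ≈⟨ sumFin-split c (laplaceTerm M) ⟩
    laplaceTerm M c + sumFin (laplaceTerm M ∘ punchIn c)
      ≈⟨ +-cong (sgn-cong (toℕ c) (trans (*-congʳ (trans (row c) (reflexive (e-diag c)))) (*-identityˡ _)))
                (sumFin-0 (λ i → trans (sgn-cong (toℕ (punchIn c i))
                   (trans (*-congʳ (trans (row (punchIn c i)) (reflexive (e-off c i)))) (zeroˡ _))) (sgn-0 (toℕ (punchIn c i))))) ⟩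
    sgn (toℕ c) (det (minor M Fin.zero c)) + 0#
      ≈⟨ +-identityʳ _ ⟩
    sgn (toℕ c) (det (minor M Fin.zero c)) ∎
  det-unitRow {suc n} M (Fin.suc r) c row = begin
    sumFin (laplaceTerm M)
      ≈⟨ sumFin-split c (laplaceTerm M) ⟩
    laplaceTerm M c + sumFin (laplaceTerm M ∘ punchIn c)
      ≈⟨ +-cong (trans (sgn-cong (toℕ c) (trans (*-congˡ (zeroRow (minor M Fin.zero c) r
                   (λ j → trans (row (punchIn c j)) (reflexive (e-off c j))))) (zeroʳ _))) (sgn-0 (toℕ c)))
                (sumFin-cong term) ⟩
    0# + sumFin (λ i → sgn (suc (toℕ r) ℕ.+ toℕ c) (laplaceTerm (minor M (Fin.suc r) c) i))
      ≈⟨ +-identityˡ _ ⟩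
    sumFin (λ i → sgn (suc (toℕ r) ℕ.+ toℕ c) (laplaceTerm (minor M (Fin.suc r) c) i))
      ≈⟨ sym (sumFin-sgn (suc (toℕ r) ℕ.+ toℕ c) (laplaceTerm (minor M (Fin.suc r) c))) ⟩
    sgn (suc (toℕ r) ℕ.+ toℕ c) (det (minor M (Fin.suc r) c)) ∎
    where
    -- the minor at column punchIn c i again has a unit row, at column partner c i
    term : ∀ i → laplaceTerm M (punchIn c i) ≈ sgn (suc (toℕ r) ℕ.+ toℕ c) (laplaceTerm (minor M (Fin.suc r) c) i)
    term i = begin
      sgn pc (X * det (minor M Fin.zero (punchIn c i)))
        ≈⟨ sgn-cong pc (*-congˡ (det-unitRow (minor M Fin.zero (punchIn c i)) r (partner c i) unit)) ⟩
      sgn pc (X * sgn rs (det (minor (minor M Fin.zero (punchIn c i)) r (partner c i))))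
        ≈⟨ sgn-cong pc (*-congˡ (sgn-cong rs (det-cong (λ a b →
             reflexive (P.cong (M (Fin.suc (punchIn r a))) (P.sym (partner-columns c i b))))))) ⟩
      sgn pc (X * sgn rs D)
        ≈⟨ sgn-cong pc (sym (sgn-*ʳ rs X D)) ⟩
      sgn pc (sgn rs (X * D))
        ≈⟨ unitRow-sgn c i (toℕ r) (X * D) ⟩
      sgn (suc (toℕ r) ℕ.+ toℕ c) (sgn (toℕ i) (X * D)) ∎
      where
      pc = toℕ (punchIn c i)
      rs = toℕ r ℕ.+ toℕ (partner c i)
      X = M Fin.zero (punchIn c i)
      D = det (minor (minor M (Fin.suc r) c) Fin.zero i)
      unit : ∀ j → minor M Fin.zero (punchIn c i) r j ≈ e (partner c i) j
      unit j = begin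
        M (Fin.suc r) (punchIn (punchIn c i) j)
          ≈⟨ row _ ⟩
        e c (punchIn (punchIn c i) j)
          ≈⟨ reflexive (P.cong (λ z → e z (punchIn (punchIn c i) j)) (P.sym (partner-back c i))) ⟩
        e (punchIn (punchIn c i) (partner c i)) (punchIn (punchIn c i) j)
          ≈⟨ reflexive (e-punchIn (punchIn c i) (partner c i) j) ⟩
        e (partner c i) j ∎

  sum-partnerCancel : ∀ {n} (T : Fin (suc (suc n)) → Fin (suc n) → A) →
    (∀ j c → T j c ≈ - T (punchIn j c) (partner j c)) →
    sumFin (λ j → sumFin (T j)) ≈ 0#
  sum-partnerCancel {zero} T anti = begin
    (T Fin.zero Fin.zero + 0#) + ((T (Fin.suc Fin.zero) Fin.zero + 0#) + 0#)
      ≈⟨ +-cong (+-identityʳ _) (trans (+-identityʳ _) (+-identityʳ _)) ⟩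
    T Fin.zero Fin.zero + T (Fin.suc Fin.zero) Fin.zero
      ≈⟨ +-congʳ (anti Fin.zero Fin.zero) ⟩
    - T (Fin.suc Fin.zero) Fin.zero + T (Fin.suc Fin.zero) Fin.zero
      ≈⟨ -‿inverseˡ _ ⟩
    0# ∎
  sum-partnerCancel {suc n} T anti = begin
    sumFin (T Fin.zero) + sumFin (λ j → T (Fin.suc j) Fin.zero + sumFin (T (Fin.suc j) ∘ Fin.suc))
      ≈⟨ +-congˡ (sumFin-+ (λ j → T (Fin.suc j) Fin.zero) (λ j → sumFin (T (Fin.suc j) ∘ Fin.suc))) ⟩
    sumFin (T Fin.zero) + (sumFin (λ j → T (Fin.suc j) Fin.zero) + sumFin (λ j → sumFin (T (Fin.suc j) ∘ Fin.suc)))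
      ≈⟨ +-congˡ (+-congˡ (sum-partnerCancel (λ j c → T (Fin.suc j) (Fin.suc c)) (λ j c → anti (Fin.suc j) (Fin.suc c)))) ⟩
    sumFin (T Fin.zero) + (sumFin (λ j → T (Fin.suc j) Fin.zero) + 0#)
      ≈⟨ +-congˡ (+-identityʳ _) ⟩
    sumFin (T Fin.zero) + sumFin (λ j → T (Fin.suc j) Fin.zero)
      ≈⟨ +-congʳ (sumFin-cong (anti Fin.zero)) ⟩
    sumFin (λ c → - T (Fin.suc c) Fin.zero) + sumFin (λ j → T (Fin.suc j) Fin.zero)
      ≈⟨ sym (sumFin-+ (λ c → - T (Fin.suc c) Fin.zero) (λ c → T (Fin.suc c) Fin.zero)) ⟩
    sumFin (λ c → - T (Fin.suc c) Fin.zero + T (Fin.suc c) Fin.zero)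
      ≈⟨ sumFin-0 (λ c → -‿inverseˡ (T (Fin.suc c) Fin.zero)) ⟩
    0# ∎

  -- a matrix whose first two rows agree has determinant 0: expanding along
  -- both rows, the terms for the two orders of each pair of columns cancel
  det-equalRows01 : ∀ {n} (M : Mat (suc (suc n))) → (∀ j → M Fin.zero j ≈ M (Fin.suc Fin.zero) j) → det M ≈ 0#
  det-equalRows01 {n} M rows≈ = begin
    sumFin (λ j → sgn (toℕ j) (M₀ j * sumFin (λ c → sgn (toℕ c) (M₁ (punchIn j c) * D j c))))
      ≈⟨ sumFin-cong (λ j → trans (sgn-cong (toℕ j) (sumFin-*ˡ (M₀ j) (λ c → sgn (toℕ c) (M₁ (punchIn j c) * D j c))))
                                  (sumFin-sgn (toℕ j) (λ c → M₀ j * sgn (toℕ c) (M₁ (punchIn j c) * D j c)))) ⟩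
    sumFin (λ j → sumFin (T j))
      ≈⟨ sum-partnerCancel T anti ⟩
    0# ∎
    where
    M₀ = M Fin.zero
    M₁ = M (Fin.suc Fin.zero)
    D : Fin (suc (suc n)) → Fin (suc n) → A
    D j c = det (λ a b → M (Fin.suc (Fin.suc a)) (punchIn j (punchIn c b)))
    T : Fin (suc (suc n)) → Fin (suc n) → A
    T j c = sgn (toℕ j) (M₀ j * sgn (toℕ c) (M₁ (punchIn j c) * D j c))
    T′ : Fin (suc (suc n)) → Fin (suc n) → A
    T′ j c = sgn (toℕ j ℕ.+ toℕ c) (M₀ j * (M₀ (punchIn j c) * D j c))
    T≈T′ : ∀ j c → T j c ≈ T′ j c
    T≈T′ j c = begin
      sgn (toℕ j) (M₀ j * sgn (toℕ c) (M₁ (punchIn j c) * D j c))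
        ≈⟨ sgn-cong (toℕ j) (sym (sgn-*ʳ (toℕ c) _ _)) ⟩
      sgn (toℕ j) (sgn (toℕ c) (M₀ j * (M₁ (punchIn j c) * D j c)))
        ≈⟨ sym (sgn-+ℕ (toℕ j) (toℕ c) _) ⟩
      sgn (toℕ j ℕ.+ toℕ c) (M₀ j * (M₁ (punchIn j c) * D j c))
        ≈⟨ sgn-cong (toℕ j ℕ.+ toℕ c) (*-congˡ (*-congʳ (sym (rows≈ (punchIn j c))))) ⟩
      T′ j c ∎
    anti : ∀ j c → T j c ≈ - T (punchIn j c) (partner j c)
    anti j c = begin
      T j c          ≈⟨ T≈T′ j c ⟩
      T′ j c         ≈⟨ sym (-‿involutive _) ⟩
      - - T′ j c     ≈⟨ -‿cong (sym partnerTerm) ⟩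
      - T (punchIn j c) (partner j c) ∎
      where
      pj = punchIn j c
      sp = toℕ pj ℕ.+ toℕ (partner j c)
      partnerTerm : T pj (partner j c) ≈ - T′ j c
      partnerTerm = begin
        T pj (partner j c) ≈⟨ T≈T′ pj (partner j c) ⟩
        sgn sp (M₀ pj * (M₀ (punchIn pj (partner j c)) * D pj (partner j c)))
          ≈⟨ sgn-cong sp (*-congˡ (*-cong (reflexive (P.cong M₀ (partner-back j c)))
                   (det-cong (λ a b → reflexive (P.cong (M (Fin.suc (Fin.suc a))) (P.sym (partner-columns j c b))))))) ⟩
        sgn sp (M₀ pj * (M₀ j * D j c))
          ≈⟨ partner-sgn j c _ ⟩
        - sgn (toℕ j ℕ.+ toℕ c) (M₀ pj * (M₀ j * D j c))
          ≈⟨ -‿cong (sgn-cong (toℕ j ℕ.+ toℕ c) (*-Comm.x∙yz≈y∙xz _ _ _)) ⟩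
        - T′ j c ∎

  setRows : ∀ {n} → Mat n → Fin n → Fin n → (Fin n → A) → (Fin n → A) → Mat n
  setRows M r s u v i = if δ i r then u else (if δ i s then v else M i)

  setRows-r : ∀ {n} (M : Mat n) r s u v → setRows M r s u v r ≡ u
  setRows-r M r s u v rewrite δ-refl r = P.refl

  setRows-s : ∀ {n} (M : Mat (suc n)) r s u v → setRows M r (punchIn r s) u v (punchIn r s) ≡ v
  setRows-s M r s u v rewrite δ-punchInˡ r s | δ-refl (punchIn r s) = P.refl

  setRows-offʳ : ∀ {n} (M : Mat (suc n)) r s u u′ v i → setRows M r s u v (punchIn r i) ≡ setRows M r s u′ v (punchIn r i)
  setRows-offʳ M r s u u′ v i rewrite δ-punchInˡ r i = P.refl

  setRows-offˢ : ∀ {n} (M : Mat (suc n)) r s u v v′ i →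
    setRows M r (punchIn r s) u v (punchIn (punchIn r s) i) ≡ setRows M r (punchIn r s) u v′ (punchIn (punchIn r s) i)
  setRows-offˢ M r s u v v′ i with δ (punchIn (punchIn r s) i) r
  ... | true = P.refl
  ... | false rewrite δ-punchInˡ (punchIn r s) i = P.refl

  setRows-id : ∀ {n} (M : Mat n) r s i j → setRows M r s (M r) (M s) i j ≡ M i j
  setRows-id M r s i j with δ i r in eqr
  ... | true rewrite δ-sound i r eqr = P.refl
  ... | false with δ i s in eqs
  ... | true rewrite δ-sound i s eqs = P.refl
  ... | false = P.refl

  setRows-off : ∀ {n} (M : Mat n) r s u v z → δ z r ≡ false → δ z s ≡ false → setRows M r s u v z ≡ M z
  setRows-off M r s u v z z≢r z≢s rewrite z≢r | z≢s = P.refl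

  Alternating : ℕ → Set
  Alternating n = ∀ (M : Mat (suc n)) r s → (∀ j → M r j ≈ M (punchIn r s) j) → det M ≈ 0#

  -- For alternating determinants, swapping two rows changes the sign:
  -- Φ(u, v) = det with rows r, s set to u, v is bilinear and Φ(w, w) = 0.
  module SwapRows {n} (alternating : Alternating n) (M : Mat (suc n)) (r : Fin (suc n)) (s′ : Fin n) where
    s = punchIn r s′

    Φ : (Fin (suc n) → A) → (Fin (suc n) → A) → A
    Φ u v = det (setRows M r s u v)

    Φ-linearˡ : ∀ u u′ v → Φ (λ j → u j + u′ j) v ≈ Φ u v + Φ u′ v
    Φ-linearˡ u u′ v = trans (linear (setRows M r s (λ j → u j + u′ j) v) (setRows M r s u v) (setRows M r s u′ v) r 1# 1#
      (λ i → at (setRows-offʳ M r s _ _ v i))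
      (λ i → at (setRows-offʳ M r s _ _ v i))
      (λ j → begin
         setRows M r s (λ j → u j + u′ j) v r j ≈⟨ at (setRows-r M r s _ v) j ⟩
         u j + u′ j ≈⟨ sym (+-cong (*-identityˡ _) (*-identityˡ _)) ⟩
         1# * u j + 1# * u′ j ≈⟨ sym (+-cong (*-congˡ (at (setRows-r M r s u v) j))
                                            (*-congˡ (at (setRows-r M r s u′ v) j))) ⟩
         1# * setRows M r s u v r j + 1# * setRows M r s u′ v r j ∎))
      (+-cong (*-identityˡ _) (*-identityˡ _))

    Φ-linearʳ : ∀ u v v′ → Φ u (λ j → v j + v′ j) ≈ Φ u v + Φ u v′
    Φ-linearʳ u v v′ = trans (linear (setRows M r s u (λ j → v j + v′ j)) (setRows M r s u v) (setRows M r s u v′) s 1# 1#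
      (λ i → at (setRows-offˢ M r s′ u _ _ i))
      (λ i → at (setRows-offˢ M r s′ u _ _ i))
      (λ j → begin
         setRows M r s u (λ j → v j + v′ j) s j ≈⟨ at (setRows-s M r s′ u _) j ⟩
         v j + v′ j ≈⟨ sym (+-cong (*-identityˡ _) (*-identityˡ _)) ⟩
         1# * v j + 1# * v′ j ≈⟨ sym (+-cong (*-congˡ (at (setRows-s M r s′ u v) j))
                                            (*-congˡ (at (setRows-s M r s′ u v′) j))) ⟩
         1# * setRows M r s u v s j + 1# * setRows M r s u v′ s j ∎))
      (+-cong (*-identityˡ _) (*-identityˡ _))

    Φ-diagonal : ∀ w → Φ w w ≈ 0#
    Φ-diagonal w = alternating (setRows M r s w w) r s′
      (λ j → trans (at (setRows-r M r s w w) j) (sym (at (setRows-s M r s′ w w) j)))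

    Φ-antisymmetric : ∀ u v → Φ u v + Φ v u ≈ 0#
    Φ-antisymmetric u v = begin
      Φ u v + Φ v u                                   ≈⟨ sym (+-cong (+-identityˡ _) (+-identityʳ _)) ⟩
      (0# + Φ u v) + (Φ v u + 0#)                     ≈⟨ sym (+-cong (+-congʳ (Φ-diagonal u)) (+-congˡ (Φ-diagonal v))) ⟩
      (Φ u u + Φ u v) + (Φ v u + Φ v v)               ≈⟨ sym (+-cong (Φ-linearʳ u u v) (Φ-linearʳ v u v)) ⟩
      Φ u (λ j → u j + v j) + Φ v (λ j → u j + v j)   ≈⟨ sym (Φ-linearˡ u v _) ⟩
      Φ (λ j → u j + v j) (λ j → u j + v j)           ≈⟨ Φ-diagonal _ ⟩
      0#                                              ∎

    det-swap : det (setRows M r s (M s) (M r)) ≈ - det M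
    det-swap = begin
      Φ (M s) (M r)  ≈⟨ inverseˡ-unique _ _ (trans (+-comm _ _) (Φ-antisymmetric (M r) (M s))) ⟩
      - Φ (M r) (M s) ≈⟨ -‿cong (det-cong (λ i j → reflexive (setRows-id M r s i j))) ⟩
      - det M ∎

  -- equal rows 0 and t+1: swap rows 1 and t+1 inside every minor of the
  -- Laplace expansion, which reduces to `det-equalRows01`
  alternating-row0 : ∀ {n} → Alternating n → (M : Mat (suc (suc n))) (t : Fin (suc n)) →
                     (∀ j → M Fin.zero j ≈ M (Fin.suc t) j) → det M ≈ 0#
  alternating-row0 alternating M Fin.zero rows≈ = det-equalRows01 M rows≈
  alternating-row0 {suc n} alternating M (Fin.suc s′) rows≈ = begin
    det M       ≈⟨ sym (-‿involutive _) ⟩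
    - - det M   ≈⟨ -‿cong (sym det-M′) ⟩
    - det M′    ≈⟨ -‿cong (det-equalRows01 M′ rows≈) ⟩
    - 0#        ≈⟨ -0#≈0# ⟩
    0#          ∎
    where
    r₁ : Fin (suc (suc (suc n)))
    r₁ = Fin.suc Fin.zero
    M′ = setRows M r₁ (punchIn r₁ (Fin.suc s′)) (M (punchIn r₁ (Fin.suc s′))) (M r₁)
    minor-M′ : ∀ j a b → minor M′ Fin.zero j a b ≡
      setRows (minor M Fin.zero j) Fin.zero (Fin.suc s′) (minor M Fin.zero j (Fin.suc s′)) (minor M Fin.zero j Fin.zero) a b
    minor-M′ j a b with δ a Fin.zero
    ... | true = P.refl
    ... | false with δ a (Fin.suc s′)
    ... | true = P.refl
    ... | false = P.refl
    det-M′ : det M′ ≈ - det M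
    det-M′ = begin
      sumFin (λ j → sgn (toℕ j) (M Fin.zero j * det (minor M′ Fin.zero j)))
        ≈⟨ sumFin-cong (λ j → sgn-cong (toℕ j) (*-congˡ {M Fin.zero j} (trans (det-cong (λ a b → reflexive (minor-M′ j a b)))
                         (SwapRows.det-swap alternating (minor M Fin.zero j) Fin.zero s′)))) ⟩
      sumFin (λ j → sgn (toℕ j) (M Fin.zero j * - det (minor M Fin.zero j)))
        ≈⟨ sumFin-cong (λ j → trans (sgn-cong (toℕ j) (sym (-‿distribʳ-* (M Fin.zero j) (det (minor M Fin.zero j)))))
                                    (sgn-neg (toℕ j) (M Fin.zero j * det (minor M Fin.zero j)))) ⟩
      sumFin (λ j → - laplaceTerm M j)
        ≈⟨ sym (sumFin-sgn 1 (laplaceTerm M)) ⟩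
      - det M ∎

  -- Alternation, by induction on the size: equal rows in the first row reduce to
  -- `alternating-row0`, otherwise expand along the first row
  det-equalRows : ∀ {n} → Alternating n
  det-equalRows {zero} M r () rows≈
  det-equalRows {suc n} M Fin.zero t rows≈ = alternating-row0 det-equalRows M t rows≈
  det-equalRows {suc n} M (Fin.suc r) Fin.zero rows≈ = alternating-row0 det-equalRows M r (λ j → sym (rows≈ j))
  det-equalRows {suc n} M (Fin.suc r) (Fin.suc s) rows≈ =
    sumFin-0 (λ j → trans (sgn-cong (toℕ j) (trans (*-congˡ (det-equalRows (minor M Fin.zero j) r s (rows≈ ∘ punchIn j)))
                                                   (zeroʳ (M Fin.zero j))))
                          (sgn-0 (toℕ j)))

  det-swapRows : ∀ {n} (M : Mat (suc n)) r s → det (setRows M r (punchIn r s) (M (punchIn r s)) (M r)) ≈ - det M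
  det-swapRows M r s = SwapRows.det-swap det-equalRows M r s

  setRow : ∀ {n} → Mat n → Fin n → (Fin n → A) → Mat n
  setRow M k u i = if δ i k then u else M i

  setRow-k : ∀ {n} (M : Mat n) k u → setRow M k u k ≡ u
  setRow-k M k u rewrite δ-refl k = P.refl

  setRow-off : ∀ {n} (M : Mat (suc n)) k u i → setRow M k u (punchIn k i) ≡ M (punchIn k i)
  setRow-off M k u i rewrite δ-punchInˡ k i = P.refl

  setRow-off′ : ∀ {n} (M : Mat n) k u z → δ z k ≡ false → setRow M k u z ≡ M z
  setRow-off′ M k u z z≢k rewrite z≢k = P.refl

  det-unitDiagonalRow : ∀ {n} (M : Mat (suc n)) k → det (setRow M k (e k)) ≈ det (minor M k k)
  det-unitDiagonalRow M k = begin
    det (setRow M k (e k))                                    ≈⟨ det-unitRow (setRow M k (e k)) k k (at (setRow-k M k (e k))) ⟩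
    sgn (toℕ k ℕ.+ toℕ k) (det (minor (setRow M k (e k)) k k)) ≈⟨ sgn-even (toℕ k) _ ⟩
    det (minor (setRow M k (e k)) k k)                        ≈⟨ det-cong (λ i j → at (setRow-off M k (e k) i) (punchIn k j)) ⟩
    det (minor M k k)                                         ∎

  det-rowOp : ∀ {n} (M : Mat (suc n)) k m u → (∀ j → M k j ≈ u j + M (punchIn k m) j) →
              det M ≈ det (setRow M k u)
  det-rowOp M k m u row = begin
    det M
      ≈⟨ linear M (setRow M k u) (setRow M k (M (punchIn k m))) k 1# 1#
           (λ i → at (P.sym (setRow-off M k u i))) (λ i → at (P.sym (setRow-off M k _ i)))
           (λ j → trans (row j) (sym (+-cong (trans (*-identityˡ _) (at (setRow-k M k u) j))
                                             (trans (*-identityˡ _) (at (setRow-k M k _) j))))) ⟩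
    1# * det (setRow M k u) + 1# * det (setRow M k (M (punchIn k m)))
      ≈⟨ +-cong (*-identityˡ _) (trans (*-identityˡ _) (det-equalRows (setRow M k (M (punchIn k m))) k m
           (λ j → trans (at (setRow-k M k _) j) (sym (at (setRow-off M k _ m) j))))) ⟩
    det (setRow M k u) + 0#
      ≈⟨ +-identityʳ _ ⟩
    det (setRow M k u) ∎

  det-offDiagonalUnitRow : ∀ {n} (M : Mat (suc (suc n))) k m′ → let m = punchIn k m′ in
    (∀ j → M k j ≈ e m j) → det M ≈ - det (setRow (minor M m m) (partner k m′) (λ j → M m (punchIn m j)))
  det-offDiagonalUnitRow M k m′ row = begin
    det M              ≈⟨ sym (-‿involutive _) ⟩
    - - det M          ≈⟨ -‿cong (sym (det-swapRows M k m′)) ⟩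
    - det M′           ≈⟨ -‿cong (det-unitRow M′ m m (λ j → trans (at (setRows-s M k m′ (M m) (M k)) j) (row j))) ⟩
    - sgn (toℕ m ℕ.+ toℕ m) (det (minor M′ m m)) ≈⟨ -‿cong (sgn-even (toℕ m) _) ⟩
    - det (minor M′ m m) ≈⟨ -‿cong (det-cong minor-M′) ⟩
    - det N            ∎
    where
    m = punchIn k m′
    k′ = partner k m′
    M′ = setRows M k m (M m) (M k)
    N = setRow (minor M m m) k′ (λ j → M m (punchIn m j))
    minor-M′ : ∀ i j → minor M′ m m i j ≈ N i j
    minor-M′ i j with view k′ i
    ... | here = begin
          M′ (punchIn m k′) (punchIn m j) ≈⟨ reflexive (P.cong (λ z → M′ z (punchIn m j)) (partner-back k m′)) ⟩
          M′ k (punchIn m j)              ≈⟨ at (setRows-r M k m (M m) (M k)) (punchIn m j) ⟩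
          M m (punchIn m j)               ≈⟨ sym (at (setRow-k (minor M m m) k′ _) j) ⟩
          N k′ j                          ∎
    ... | there i′ = begin
          M′ z (punchIn m j)          ≈⟨ at (setRows-off M k m (M m) (M k) z (partner-avoids k m′ i′) (δ-punchInˡ m (punchIn k′ i′)))
                                             (punchIn m j) ⟩
          M z (punchIn m j)           ≈⟨ sym (at (setRow-off (minor M m m) k′ _ i′) j) ⟩
          N (punchIn k′ i′) j         ∎
      where
      z = punchIn m (punchIn k′ i′)

module AncestralPencil (R : CommutativeRing 0ℓ 0ℓ) (x y : CommutativeRing.Carrier R) where

  open import Defs using (Vertex; level; _∨v_; δ)
  open Ancestry
  open import Data.Nat using (ℕ; zero; suc)
  open import Data.Fin using (Fin; punchIn)
  open import Data.Bool using (true; false; if_then_else_)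
  open import Data.List using ([]; _∷_)
  open import Relation.Binary.PropositionalEquality as P using (_≡_)
  open import Relation.Nullary using (¬_)
  open import Function using (_∘_)

  open CommutativeRing R renaming (Carrier to A)
  open import Algebra.Properties.Ring ring using (-‿distribˡ-*; -‿distribʳ-*; -‿involutive)
  import Algebra.Properties.CommutativeSemigroup
  private
    module +-Comm = Algebra.Properties.CommutativeSemigroup +-commutativeSemigroup
  open import Relation.Binary.Reasoning.Setoid setoid
  open Indicator R
  open Determinant R

  ι : ℕ → A
  ι zero = 0#
  ι (suc n) = 1# + ι n

  pencil : ∀ {n} → (Fin n → Vertex) → Mat n
  pencil V i j = ind (δ i j) x + y * ι (level (V i ∨v V j))

  pencil-minor : ∀ {n} (V : Fin (suc n) → Vertex) k → det (minor (pencil V) k k) ≈ det (pencil (V ∘ punchIn k))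
  pencil-minor V k = det-cong (λ i j → reflexive (P.cong (λ b → ind b x + y * ι (level (V (punchIn k i) ∨v V (punchIn k j))))
                                                          (δ-punchIn k i j)))

  pencil-unitDiagonalRow : ∀ {n} (V : Fin (suc n) → Vertex) k → det (setRow (pencil V) k (e k)) ≈ det (pencil (V ∘ punchIn k))
  pencil-unitDiagonalRow V k = trans (det-unitDiagonalRow (pencil V) k) (pencil-minor V k)

  det-rootVertex : ∀ {n} (V : Fin (suc n) → Vertex) k → V k ≡ [] →
                   det (pencil V) ≈ x * det (pencil (V ∘ punchIn k))
  det-rootVertex V k Vk≡root = begin
    det (pencil V)
      ≈⟨ linear (pencil V) (setRow (pencil V) k (e k)) (pencil V) k x 0#
           (λ i → at (P.sym (setRow-off (pencil V) k (e k) i))) (λ i j → refl) row ⟩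
    x * det (setRow (pencil V) k (e k)) + 0# * det (pencil V)
      ≈⟨ +-cong (*-congˡ (pencil-unitDiagonalRow V k)) (zeroˡ _) ⟩
    x * det (pencil (V ∘ punchIn k)) + 0#
      ≈⟨ +-identityʳ _ ⟩
    x * det (pencil (V ∘ punchIn k)) ∎
    where
    -- the root meets every vertex at level 0, so row k is x·e k
    row : ∀ j → pencil V k j ≈ x * setRow (pencil V) k (e k) k j + 0# * pencil V k j
    row j = begin
      pencil V k j              ≈⟨ reflexive (P.cong (λ v → ind (δ k j) x + y * ι (level (v ∨v V j))) Vk≡root) ⟩
      ind (δ k j) x + y * 0#    ≈⟨ +-cong (ind-unit (δ k j) x) (zeroʳ y) ⟩
      x * e k j + 0#            ≈⟨ +-cong (*-congˡ (sym (at (setRow-k (pencil V) k (e k)) j))) (sym (zeroˡ _)) ⟩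
      x * setRow (pencil V) k (e k) k j + 0# * pencil V k j ∎

  setVertex : ∀ {n} → (Fin n → Vertex) → Fin n → Vertex → Fin n → Vertex
  setVertex V k p i = if δ i k then p else V i

  setVertex-k : ∀ {n} (V : Fin n → Vertex) k p → setVertex V k p k ≡ p
  setVertex-k V k p rewrite δ-refl k = P.refl

  setVertex-off : ∀ {n} (V : Fin (suc n) → Vertex) k p i → setVertex V k p (punchIn k i) ≡ V (punchIn k i)
  setVertex-off V k p i rewrite δ-punchInˡ k i = P.refl

  -- Rule 2: if v = V k is not the root and no other vertex of the family
  -- lies below v, then moving v to its parent lowers only the (k,k) entry,
  -- by y; linearity in row k splits off y times the principal minor.
  det-privateEdge : ∀ {n} (V : Fin (suc n) → Vertex) k a u → V k ≡ a ∷ u →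
    (∀ i → ¬ (a ∷ u) ≼ V (punchIn k i)) →
    det (pencil V) ≈ det (pencil (setVertex V k (parent (a ∷ u)))) + y * det (pencil (V ∘ punchIn k))
  det-privateEdge V k a u Vk≡v v-private = begin
    det (pencil V)
      ≈⟨ linear (pencil V) (pencil V′) (setRow (pencil V) k (e k)) k 1# y same-off-k
           (λ i → at (P.sym (setRow-off (pencil V) k (e k) i))) row ⟩
    1# * det (pencil V′) + y * det (setRow (pencil V) k (e k))
      ≈⟨ +-cong (*-identityˡ _) (*-congˡ (pencil-unitDiagonalRow V k)) ⟩
    det (pencil V′) + y * det (pencil (V ∘ punchIn k)) ∎
    where
    p = parent (a ∷ u)
    V′ = setVertex V k p
    meet-k : ∀ i′ → level (V k ∨v V (punchIn k i′)) ≡ level (V′ k ∨v V′ (punchIn k i′))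
    meet-k i′ = P.trans (P.cong (λ v → level (v ∨v V (punchIn k i′))) Vk≡v)
                  (P.trans (∨v-parentˡ a u (V (punchIn k i′)) (v-private i′))
                    (P.cong₂ (λ v w → level (v ∨v w)) (P.sym (setVertex-k V k p)) (P.sym (setVertex-off V k p i′))))
    meet-off : ∀ i′ j → level (V (punchIn k i′) ∨v V j) ≡ level (V′ (punchIn k i′) ∨v V′ j)
    meet-off i′ j with view k j
    ... | here = P.trans (P.cong (λ v → level (V (punchIn k i′) ∨v v)) Vk≡v)
                   (P.trans (∨v-parentʳ a u (V (punchIn k i′)) (v-private i′))
                     (P.cong₂ (λ v w → level (v ∨v w)) (P.sym (setVertex-off V k p i′)) (P.sym (setVertex-k V k p))))
    ... | there j′ = P.cong₂ (λ v w → level (v ∨v w)) (P.sym (setVertex-off V k p i′)) (P.sym (setVertex-off V k p j′))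
    same-off-k : ∀ i j → pencil V (punchIn k i) j ≈ pencil V′ (punchIn k i) j
    same-off-k i j = reflexive (P.cong (λ l → ind (δ (punchIn k i) j) x + y * ι l) (meet-off i j))
    -- the diagonal entry: level v = 1 + level p
    row : ∀ j → pencil V k j ≈ 1# * pencil V′ k j + y * setRow (pencil V) k (e k) k j
    row j with view k j
    ... | here = begin
          ind (δ k k) x + y * ι (level (V k ∨v V k))
            ≈⟨ reflexive (P.cong (λ l → ind (δ k k) x + y * ι l)
                 (P.trans (P.cong level (∨v-idem (V k))) (P.trans (P.cong level Vk≡v) (level-parent a u)))) ⟩
          ind (δ k k) x + y * (1# + ι (level p))
            ≈⟨ trans (+-congˡ (distribˡ y 1# (ι (level p))))
                 (trans (+-Comm.x∙yz≈xz∙y (ind (δ k k) x) (y * 1#) (y * ι (level p))) (+-congʳ (sym (*-identityˡ _)))) ⟩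
          1# * (ind (δ k k) x + y * ι (level p)) + y * 1#
            ≈⟨ +-cong (*-congˡ (reflexive (P.cong (λ l → ind (δ k k) x + y * ι l)
                   (P.sym (P.trans (P.cong (λ v → level (v ∨v v)) (setVertex-k V k p)) (P.cong level (∨v-idem p)))))))
                 (*-congˡ (sym (trans (at (setRow-k (pencil V) k (e k)) k) (reflexive (e-diag k))))) ⟩
          1# * pencil V′ k k + y * setRow (pencil V) k (e k) k k ∎
    ... | there j′ = begin
          pencil V k (punchIn k j′)
            ≈⟨ reflexive (P.cong (λ l → ind (δ k (punchIn k j′)) x + y * ι l) (meet-k j′)) ⟩
          pencil V′ k (punchIn k j′)
            ≈⟨ sym (trans (+-congˡ (trans (*-congˡ (trans (at (setRow-k (pencil V) k (e k)) (punchIn k j′))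
                                                        (reflexive (e-off k j′))))
                                          (zeroʳ y)))
                          (trans (+-identityʳ _) (*-identityˡ _))) ⟩
          1# * pencil V′ k (punchIn k j′) + y * setRow (pencil V) k (e k) k (punchIn k j′) ∎

  det-pencil-offDiagonal : ∀ {n} (W : Fin (suc n) → Vertex) k (r : Fin (suc n) → A) →
    (∀ j → r j ≈ 1# * pencil W k j + (- x) * e k j) →
    det (setRow (pencil W) k r) ≈ 1# * det (pencil W) + (- x) * det (pencil (W ∘ punchIn k))
  det-pencil-offDiagonal W k r row = begin
    det (setRow (pencil W) k r)
      ≈⟨ linear (setRow (pencil W) k r) (pencil W) (setRow (pencil W) k (e k)) k 1# (- x)
           (λ i → at (setRow-off (pencil W) k r i))
           (λ i → at (P.trans (setRow-off (pencil W) k r i) (P.sym (setRow-off (pencil W) k (e k) i))))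
           (λ j → trans (at (setRow-k (pencil W) k r) j)
                        (trans (row j) (+-congˡ (*-congˡ (sym (at (setRow-k (pencil W) k (e k)) j)))))) ⟩
    1# * det (pencil W) + (- x) * det (setRow (pencil W) k (e k))
      ≈⟨ +-congˡ (*-congˡ (pencil-unitDiagonalRow W k)) ⟩
    1# * det (pencil W) + (- x) * det (pencil (W ∘ punchIn k)) ∎

  -- If V k = V m with m = punchIn k m′, replacing row k by the unit row e m
  -- leaves (up to sign) the minor at m whose row for k is row m of the
  -- pencil: the pencil row of the same vertex without its diagonal x.
  det-pencil-unitRowAtCopy : ∀ {n} (V : Fin (suc (suc n)) → Vertex) k m′ → V k ≡ V (punchIn k m′) →
    let m = punchIn k m′ in
    det (setRow (pencil V) k (e m)) ≈
      - (1# * det (pencil (V ∘ punchIn m)) + (- x) * det (pencil (V ∘ punchIn m ∘ punchIn (partner k m′))))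
  det-pencil-unitRowAtCopy V k m′ Vk≡Vm = begin
    det (setRow M k (e m))
      ≈⟨ det-offDiagonalUnitRow (setRow M k (e m)) k m′ (at (setRow-k M k (e m))) ⟩
    - det (setRow (minor (setRow M k (e m)) m m) k′ (λ j → setRow M k (e m) m (punchIn m j)))
      ≈⟨ -‿cong (det-cong same) ⟩
    - det (setRow (pencil (V ∘ punchIn m)) k′ (λ j → M m (punchIn m j)))
      ≈⟨ -‿cong (det-pencil-offDiagonal (V ∘ punchIn m) k′ (λ j → M m (punchIn m j)) row-m) ⟩
    - (1# * det (pencil (V ∘ punchIn m)) + (- x) * det (pencil (V ∘ punchIn m ∘ punchIn k′))) ∎
    where
    M = pencil V
    m = punchIn k m′
    k′ = partner k m′
    L = setRow (minor (setRow M k (e m)) m m) k′ (λ j → setRow M k (e m) m (punchIn m j))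
    N = setRow (pencil (V ∘ punchIn m)) k′ (λ j → M m (punchIn m j))
    same : ∀ i j → L i j ≈ N i j
    same i j with view k′ i
    ... | here = begin
          L k′ j                           ≈⟨ at (setRow-k (minor (setRow M k (e m)) m m) k′ _) j ⟩
          setRow M k (e m) m (punchIn m j) ≈⟨ at (setRow-off M k (e m) m′) (punchIn m j) ⟩
          M m (punchIn m j)                ≈⟨ sym (at (setRow-k (pencil (V ∘ punchIn m)) k′ _) j) ⟩
          N k′ j                           ∎
    ... | there i′ = begin
          L (punchIn k′ i′) j                      ≈⟨ at (setRow-off (minor (setRow M k (e m)) m m) k′ _ i′) j ⟩
          setRow M k (e m) z (punchIn m j)         ≈⟨ at (setRow-off′ M k (e m) z (partner-avoids k m′ i′)) (punchIn m j) ⟩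
          M z (punchIn m j)                        ≈⟨ reflexive (P.cong (λ b → ind b x + y * ι (level (V z ∨v V (punchIn m j))))
                                                                        (δ-punchIn m (punchIn k′ i′) j)) ⟩
          pencil (V ∘ punchIn m) (punchIn k′ i′) j ≈⟨ sym (at (setRow-off (pencil (V ∘ punchIn m)) k′ _ i′) j) ⟩
          N (punchIn k′ i′) j                      ∎
      where z = punchIn m (punchIn k′ i′)
    row-m : ∀ j → M m (punchIn m j) ≈ 1# * pencil (V ∘ punchIn m) k′ j + (- x) * e k′ j
    row-m j = begin
      ind (δ m (punchIn m j)) x + Y ≈⟨ +-congʳ (reflexive (P.cong (λ b → ind b x) (δ-punchInʳ m j))) ⟩
      0# + Y                        ≈⟨ diagonal (δ k′ j) ⟩
      1# * (ind (δ k′ j) x + Y) + (- x) * e k′ j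
        ≈⟨ +-congʳ (*-congˡ (+-congˡ (reflexive (P.cong (λ v → y * ι (level (v ∨v V (punchIn m j))))
              (P.trans (P.sym Vk≡Vm) (P.cong V (P.sym (partner-back k m′)))))))) ⟩
      1# * pencil (V ∘ punchIn m) k′ j + (- x) * e k′ j ∎
      where
      Y = y * ι (level (V m ∨v V (punchIn m j)))
      diagonal : ∀ b → 0# + Y ≈ 1# * (ind b x + Y) + (- x) * ind b 1#
      diagonal true = begin
        0# + Y                    ≈⟨ +-congʳ (sym (-‿inverseʳ x)) ⟩
        (x + - x) + Y             ≈⟨ +-Comm.xy∙z≈xz∙y x (- x) Y ⟩
        (x + Y) + - x             ≈⟨ sym (+-cong (*-identityˡ _) (*-identityʳ _)) ⟩
        1# * (x + Y) + (- x) * 1# ∎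
      diagonal false = sym (trans (+-cong (*-identityˡ _) (zeroʳ _)) (+-identityʳ _))

  pencil-copyRows : ∀ {n} (V : Fin (suc (suc n)) → Vertex) k m′ → V k ≡ V (punchIn k m′) → let m = punchIn k m′ in
    ∀ j → pencil V k j ≈ (x * e k j + (- x) * e m j) + pencil V m j
  pencil-copyRows V k m′ Vk≡Vm j = begin
    ind (δ k j) x + y * ι (level (V k ∨v V j))
      ≈⟨ +-cong (ind-unit (δ k j) x) (reflexive (P.cong (λ v → y * ι (level (v ∨v V j))) Vk≡Vm)) ⟩
    x * e k j + Y
      ≈⟨ sym (+-congˡ (trans (+-congʳ (-‿inverseˡ (x * e m j))) (+-identityˡ Y))) ⟩
    x * e k j + ((- (x * e m j) + x * e m j) + Y)
      ≈⟨ +-congˡ (+-assoc _ _ _) ⟩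
    x * e k j + (- (x * e m j) + (x * e m j + Y))
      ≈⟨ sym (+-assoc _ _ _) ⟩
    (x * e k j + - (x * e m j)) + (x * e m j + Y)
      ≈⟨ +-cong (+-congˡ (-‿distribˡ-* x (e m j))) (+-congʳ (sym (ind-unit (δ m j) x))) ⟩
    (x * e k j + (- x) * e m j) + pencil V m j ∎
    where
    m = punchIn k m′
    Y = y * ι (level (V m ∨v V j))

  -- Rule 3: if the family contains a vertex twice, at positions k and
  -- m = punchIn k m′, then rows k and m differ by x·(e k − e m); this
  -- gives an inclusion–exclusion over removing one or both copies.
  det-repeatedVertex : ∀ {n} (V : Fin (suc (suc n)) → Vertex) k m′ → V k ≡ V (punchIn k m′) →
    det (pencil V) ≈ x * det (pencil (V ∘ punchIn k)) +
      (x * det (pencil (V ∘ punchIn (punchIn k m′))) +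
       - (x * (x * det (pencil (V ∘ punchIn (punchIn k m′) ∘ punchIn (partner k m′))))))
  det-repeatedVertex {n} V k m′ Vk≡Vm = begin
    det M
      ≈⟨ det-rowOp M k m′ u (pencil-copyRows V k m′ Vk≡Vm) ⟩
    det (setRow M k u)
      ≈⟨ linear (setRow M k u) (setRow M k (e k)) (setRow M k (e m)) k x (- x)
           (λ i → at (P.trans (setRow-off M k u i) (P.sym (setRow-off M k (e k) i))))
           (λ i → at (P.trans (setRow-off M k u i) (P.sym (setRow-off M k (e m) i))))
           (λ j → trans (at (setRow-k M k u) j)
                        (sym (+-cong (*-congˡ (at (setRow-k M k (e k)) j)) (*-congˡ (at (setRow-k M k (e m)) j))))) ⟩
    x * det (setRow M k (e k)) + (- x) * det (setRow M k (e m))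
      ≈⟨ +-cong (*-congˡ (pencil-unitDiagonalRow V k)) (*-congˡ (det-pencil-unitRowAtCopy V k m′ Vk≡Vm)) ⟩
    x * d₁ + (- x) * (- (1# * d₂ + (- x) * d₃))
      ≈⟨ +-congˡ expand ⟩
    x * d₁ + (x * d₂ + - (x * (x * d₃))) ∎
    where
    M = pencil V
    m = punchIn k m′
    d₁ = det (pencil (V ∘ punchIn k))
    d₂ = det (pencil (V ∘ punchIn m))
    d₃ = det (pencil (V ∘ punchIn m ∘ punchIn (partner k m′)))
    u : Fin (suc (suc n)) → A
    u j = x * e k j + (- x) * e m j
    expand : (- x) * (- (1# * d₂ + (- x) * d₃)) ≈ x * d₂ + - (x * (x * d₃))
    expand = begin
      (- x) * (- S)              ≈⟨ sym (-‿distribˡ-* x (- S)) ⟩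
      - (x * - S)                ≈⟨ -‿cong (sym (-‿distribʳ-* x S)) ⟩
      - - (x * S)                ≈⟨ -‿involutive _ ⟩
      x * S                      ≈⟨ distribˡ x _ _ ⟩
      x * (1# * d₂) + x * ((- x) * d₃)
        ≈⟨ +-cong (*-congˡ (*-identityˡ d₂)) (trans (*-congˡ (sym (-‿distribˡ-* x d₃))) (sym (-‿distribʳ-* x (x * d₃)))) ⟩
      x * d₂ + - (x * (x * d₃))  ∎
      where S = 1# * d₂ + (- x) * d₃

-- The weighted count of edge-disjoint collections of upward paths from a
-- list of leaves: a path with no edge has weight x, any other path weight y.
module PathSum (R : CommutativeRing 0ℓ 0ℓ) (x y : CommutativeRing.Carrier R) where

  open import Defs
  open Ancestry
  open UpwardPaths
  open Indicator R
  open import Data.Nat using (ℕ; zero; suc)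
  import Data.Nat.Properties as ℕP
  open import Data.Fin using (toℕ)
  open import Data.List using (List; []; _∷_; length; take; map; concat; foldr; upTo; applyUpTo; _++_)
  import Data.List.Properties as LP
  open import Data.List.Relation.Unary.All using (All; []; _∷_)
  open import Data.List.Relation.Binary.Permutation.Propositional as Perm using (_↭_)
  open import Data.Bool using (true; false; _∧_; _∨_; not)
  import Data.Bool.Properties as BP
  open import Relation.Binary.PropositionalEquality as P using (_≡_)
  open import Relation.Nullary using (¬_)
  open import Function using (_∘_; id)

  open CommutativeRing R renaming (Carrier to A)
  open import Algebra.Properties.Semiring.Sum semiring using (sum; sum-cong-≋; ∑-comm; *-distribˡ-sum; sum-replicate-zero)
  import Algebra.Properties.CommutativeSemigroup
  private
    module +-Comm = Algebra.Properties.CommutativeSemigroup +-commutativeSemigroup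
    module *-Comm = Algebra.Properties.CommutativeSemigroup *-commutativeSemigroup
  open import Relation.Binary.Reasoning.Setoid setoid

  sumTo : ℕ → (ℕ → A) → A
  sumTo n f = sum {n} (λ i → f (toℕ i))

  sumTo-cong : ∀ n {f g : ℕ → A} → (∀ i → f i ≈ g i) → sumTo n f ≈ sumTo n g
  sumTo-cong n f≈g = sum-cong-≋ {n} (λ i → f≈g (toℕ i))

  sumTo-0 : ∀ n {f : ℕ → A} → (∀ i → f i ≈ 0#) → sumTo n f ≈ 0#
  sumTo-0 n f≈0 = trans (sumTo-cong n f≈0) (sum-replicate-zero n)

  sumTo-≡ : ∀ {m n} (f : ℕ → A) → m ≡ n → sumTo m f ≈ sumTo n f
  sumTo-≡ f P.refl = refl

  sumTo-*ˡ : ∀ n a (f : ℕ → A) → a * sumTo n f ≈ sumTo n (λ i → a * f i)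
  sumTo-*ˡ n a f = *-distribˡ-sum {n} a (λ i → f (toℕ i))

  ind-sumTo : ∀ b c n (f : ℕ → A) → ind b (c * sumTo n f) ≈ sumTo n (λ i → ind b (c * f i))
  ind-sumTo true c n f = sumTo-*ˡ n c f
  ind-sumTo false c n f = sym (sumTo-0 n (λ _ → refl))

  w : ℕ → A
  w zero = x
  w (suc _) = y

  mutual
    -- pathSum E L: weighted sum over the collections of upward paths from
    -- the leaves L that are pairwise edge-disjoint and avoid the edges E
    pathSum : List Vertex → List Vertex → A
    pathSum E [] = 1#
    pathSum E (v ∷ L) = sumTo (suc (level v)) (pathTerm E v L)

    pathTerm : List Vertex → Vertex → List Vertex → ℕ → A
    pathTerm E v L m = ind (not (shareEdge (edgesOfPath v m) E)) (w m * pathSum (edgesOfPath v m ++ E) L)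

  AgreeOn : List Vertex → List Vertex → List Vertex → Set
  AgreeOn E F L = All (λ v → ∀ j → mem (take j v) E ≡ mem (take j v) F) L

  agreeOn-++ : ∀ P E F L → AgreeOn E F L → AgreeOn (P ++ E) (P ++ F) L
  agreeOn-++ P E F [] [] = []
  agreeOn-++ P E F (v ∷ L) (agree ∷ agrees) =
    (λ j → P.trans (mem-++ (take j v) P E) (P.trans (P.cong (mem (take j v) P ∨_) (agree j)) (P.sym (mem-++ (take j v) P F))))
    ∷ agreeOn-++ P E F L agrees

  agreeOn-all : ∀ E F L → (∀ e → mem e E ≡ mem e F) → AgreeOn E F L
  agreeOn-all E F [] E≈F = []
  agreeOn-all E F (v ∷ L) E≈F = (λ j → E≈F (take j v)) ∷ agreeOn-all E F L E≈F

  pathSum-agree : ∀ E F L → AgreeOn E F L → pathSum E L ≈ pathSum F L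
  pathSum-agree E F [] _ = refl
  pathSum-agree E F (v ∷ L) (agree ∷ agrees) = sumTo-cong (suc (level v)) λ m →
    trans (reflexive (P.cong (λ b → ind (not b) (w m * pathSum (edgesOfPath v m ++ E) L)) (shareEdge-path-cong v m E F agree)))
          (ind-cong (not (shareEdge (edgesOfPath v m) F)) (*-congˡ
            (pathSum-agree (edgesOfPath v m ++ E) (edgesOfPath v m ++ F) L (agreeOn-++ (edgesOfPath v m) E F L agrees))))

  twoPaths : List Vertex → Vertex → Vertex → List Vertex → ℕ → ℕ → A
  twoPaths E a b L m m′ =
    ind (not (shareEdge (edgesOfPath a m) E) ∧ not (shareEdge (edgesOfPath b m′) (edgesOfPath a m ++ E)))
        (w m * (w m′ * pathSum (edgesOfPath b m′ ++ edgesOfPath a m ++ E) L))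

  pathTerm-twoPaths : ∀ E a b L m → pathTerm E a (b ∷ L) m ≈ sumTo (suc (level b)) (twoPaths E a b L m)
  pathTerm-twoPaths E a b L m =
    trans (ind-sumTo (not (shareEdge Pa E)) (w m) (suc (level b)) (pathTerm (Pa ++ E) b L))
          (sumTo-cong (suc (level b)) (λ m′ →
            ind-∧ (not (shareEdge Pa E)) (not (shareEdge (edgesOfPath b m′) (Pa ++ E))) (w m)
                  (w m′ * pathSum (edgesOfPath b m′ ++ Pa ++ E) L)))
    where Pa = edgesOfPath a m

  twoPaths-swap : ∀ E a b L m m′ → twoPaths E a b L m m′ ≈ twoPaths E b a L m′ m
  twoPaths-swap E a b L m m′ =
    trans (reflexive (P.cong (λ t → ind t (w m * (w m′ * pathSum (Pb ++ Pa ++ E) L))) (disjoint-both Pa Pb E)))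
          (ind-cong (not (shareEdge Pb E) ∧ not (shareEdge Pa (Pb ++ E)))
            (trans (*-Comm.x∙yz≈y∙xz (w m) (w m′) _)
                   (*-congˡ (*-congˡ (pathSum-agree (Pb ++ Pa ++ E) (Pa ++ Pb ++ E) L
                     (agreeOn-all (Pb ++ Pa ++ E) (Pa ++ Pb ++ E) L (λ e → mem-swap e Pa Pb E)))))))
    where
    Pa = edgesOfPath a m
    Pb = edgesOfPath b m′

  pathSum-swap : ∀ E a b L → pathSum E (a ∷ b ∷ L) ≈ pathSum E (b ∷ a ∷ L)
  pathSum-swap E a b L = begin
    sumTo (suc (level a)) (pathTerm E a (b ∷ L))
      ≈⟨ sumTo-cong (suc (level a)) (pathTerm-twoPaths E a b L) ⟩
    sumTo (suc (level a)) (λ m → sumTo (suc (level b)) (twoPaths E a b L m))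
      ≈⟨ ∑-comm {suc (level a)} {suc (level b)} (λ i j → twoPaths E a b L (toℕ i) (toℕ j)) ⟩
    sumTo (suc (level b)) (λ m′ → sumTo (suc (level a)) (λ m → twoPaths E a b L m m′))
      ≈⟨ sumTo-cong (suc (level b)) (λ m′ → sumTo-cong (suc (level a)) (λ m → twoPaths-swap E a b L m m′)) ⟩
    sumTo (suc (level b)) (λ m′ → sumTo (suc (level a)) (twoPaths E b a L m′))
      ≈⟨ sym (sumTo-cong (suc (level b)) (pathTerm-twoPaths E b a L)) ⟩
    sumTo (suc (level b)) (pathTerm E b (a ∷ L)) ∎

  pathSum-prep : ∀ v {L L′} → (∀ E → pathSum E L ≈ pathSum E L′) → ∀ E → pathSum E (v ∷ L) ≈ pathSum E (v ∷ L′)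
  pathSum-prep v L≈L′ E = sumTo-cong (suc (level v)) λ m →
    ind-cong (not (shareEdge (edgesOfPath v m) E)) (*-congˡ {w m} (L≈L′ (edgesOfPath v m ++ E)))

  pathSum-perm : ∀ {L L′} → L ↭ L′ → ∀ E → pathSum E L ≈ pathSum E L′
  pathSum-perm Perm.refl E = refl
  pathSum-perm (Perm.prep {L} {L′} v L↭L′) = pathSum-prep v {L} {L′} (pathSum-perm L↭L′)
  pathSum-perm (Perm.swap {L} {L′} a b L↭L′) E =
    trans (pathSum-swap E a b L) (pathSum-prep b {a ∷ L} {a ∷ L′} (pathSum-prep a {L} {L′} (pathSum-perm L↭L′)) E)
  pathSum-perm (Perm.trans L↭L′ L′↭L″) E = trans (pathSum-perm L↭L′ E) (pathSum-perm L′↭L″ E)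

  -- Rule 1: the only path from the root is trivial
  pathSum-root : ∀ E L → pathSum E ([] ∷ L) ≈ x * pathSum E L
  pathSum-root E L = +-identityʳ _

  pathTerm-[] : ∀ v L m → pathTerm [] v L m ≈ w m * pathSum (edgesOfPath v m ++ []) L
  pathTerm-[] v L m = reflexive (P.cong (λ b → ind (not b) (w m * pathSum (edgesOfPath v m ++ []) L)) (shareEdge-[]ʳ (edgesOfPath v m)))

  nontrivialPart : Vertex → List Vertex → A
  nontrivialPart v L = sumTo (level v) (λ m → y * pathSum (edgesOfPath v (suc m) ++ []) L)

  pathSum-split : ∀ v L → pathSum [] (v ∷ L) ≈ x * pathSum [] L + nontrivialPart v L
  pathSum-split v L = trans (sumTo-cong (suc (level v)) (pathTerm-[] v L))
    (+-congʳ (*-congˡ (reflexive (P.cong (λ Q → pathSum (Q ++ []) L) (edgesOfPath-trivial v)))))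

  agreeOn-dropEdge : ∀ v Q L → All (λ z → ¬ v ≼ z) L → AgreeOn ((Q ++ v ∷ []) ++ []) (Q ++ []) L
  agreeOn-dropEdge v Q [] [] = []
  agreeOn-dropEdge v Q (z ∷ L) (v⋠z ∷ v⋠L) = invisible ∷ agreeOn-dropEdge v Q L v⋠L
    where
    invisible : ∀ j → mem (take j z) ((Q ++ v ∷ []) ++ []) ≡ mem (take j z) (Q ++ [])
    invisible j rewrite mem-++ (take j z) (Q ++ v ∷ []) [] | mem-++ (take j z) Q (v ∷ [])
                      | take-==v-non-ancestor v z j v⋠z | mem-++ (take j z) Q [] =
      P.cong (_∨ false) (BP.∨-identityʳ (mem (take j z) Q))

  -- Rule 2: if no other leaf lies below v, a non-trivial path from v is
  -- the edge above v followed by a path from its parent, and the trivial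
  -- path from the parent corresponds to the path from v of length one
  pathSum-privateEdge : ∀ a u L → All (λ z → ¬ (a ∷ u) ≼ z) L →
    pathSum [] ((a ∷ u) ∷ L) ≈ pathSum [] (parent (a ∷ u) ∷ L) + y * pathSum [] L
  pathSum-privateEdge a u L v-private = begin
    pathSum [] (v ∷ L)                        ≈⟨ pathSum-split v L ⟩
    x * pathSum [] L + nontrivialPart v L     ≈⟨ +-congˡ shift ⟩
    x * pathSum [] L + (y * pathSum [] L + nontrivialPart p L)
                                              ≈⟨ +-Comm.x∙yz≈xz∙y _ _ _ ⟩
    (x * pathSum [] L + nontrivialPart p L) + y * pathSum [] L
                                              ≈⟨ +-congʳ (sym (pathSum-split p L)) ⟩
    pathSum [] (p ∷ L) + y * pathSum [] L     ∎
    where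
    v = a ∷ u
    p = parent v
    shift : nontrivialPart v L ≈ y * pathSum [] L + nontrivialPart p L
    shift = begin
      sumTo (suc (length u)) (λ m → y * pathSum (edgesOfPath v (suc m) ++ []) L)
        ≈⟨ sumTo-cong (suc (length u)) (λ m → *-congˡ {y} (pathSum-agree (edgesOfPath v (suc m) ++ []) (edgesOfPath p m ++ []) L
             (P.subst (λ Q → AgreeOn (Q ++ []) (edgesOfPath p m ++ []) L) (P.sym (edgesOfPath-step a u m))
                      (agreeOn-dropEdge v (edgesOfPath p m) L v-private)))) ⟩
      sumTo (suc (length u)) (λ m → y * pathSum (edgesOfPath p m ++ []) L)
        ≈⟨ +-cong (*-congˡ (reflexive (P.cong (λ Q → pathSum (Q ++ []) L) (edgesOfPath-trivial p))))
                  (sumTo-≡ (λ m → y * pathSum (edgesOfPath p (suc m) ++ []) L) (P.sym level-p)) ⟩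
      y * pathSum [] L + nontrivialPart p L ∎
      where
      level-p : level p ≡ length u
      level-p = ℕP.suc-injective (P.sym (level-parent a u))

  -- Rule 3: of two copies of a leaf at most one has a non-trivial path;
  -- inclusion–exclusion over which copy has the trivial path
  pathSum-repeated : ∀ a u L → pathSum [] ((a ∷ u) ∷ (a ∷ u) ∷ L) ≈
    x * pathSum [] ((a ∷ u) ∷ L) + (x * pathSum [] ((a ∷ u) ∷ L) + - (x * (x * pathSum [] L)))
  pathSum-repeated a u L = begin
    pathSum [] (v ∷ v ∷ L)                  ≈⟨ pathSum-split v (v ∷ L) ⟩
    x * Gv + nontrivialPart v (v ∷ L)       ≈⟨ +-congˡ second-trivial ⟩
    x * Gv + x * nontrivialPart v L         ≈⟨ +-congˡ inclusion-exclusion ⟩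
    x * Gv + (x * Gv + - (x * (x * G)))     ∎
    where
    v = a ∷ u
    G = pathSum [] L
    Gv = pathSum [] (v ∷ L)
    -- once the first copy has a non-trivial path, the second has the trivial one
    only-trivial : ∀ m → pathSum (edgesOfPath v (suc m) ++ []) (v ∷ L) ≈ x * pathSum (edgesOfPath v (suc m) ++ []) L
    only-trivial m = begin
      pathTerm Q v L 0 + sumTo (level v) (λ m′ → pathTerm Q v L (suc m′))
        ≈⟨ +-cong (reflexive (P.cong (λ T → ind (not (shareEdge T Q)) (x * pathSum (T ++ Q) L)) (edgesOfPath-trivial v)))
                  (sumTo-0 (level v) (λ m′ → reflexive (P.cong (λ b → ind (not b) (y * pathSum (edgesOfPath v (suc m′) ++ Q) L))
                                                                  (nontrivial-paths-share a u m′ m [])))) ⟩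
      x * pathSum Q L + 0#  ≈⟨ +-identityʳ _ ⟩
      x * pathSum Q L       ∎
      where Q = edgesOfPath v (suc m) ++ []
    second-trivial : nontrivialPart v (v ∷ L) ≈ x * nontrivialPart v L
    second-trivial = trans (sumTo-cong (level v) (λ m → trans (*-congˡ (only-trivial m)) (*-Comm.x∙yz≈y∙xz y x _)))
                           (sym (sumTo-*ˡ (level v) x (λ m → y * pathSum (edgesOfPath v (suc m) ++ []) L)))
    inclusion-exclusion : x * nontrivialPart v L ≈ x * Gv + - (x * (x * G))
    inclusion-exclusion = sym (begin
      x * Gv + - (x * (x * G))                              ≈⟨ +-congʳ (*-congˡ (pathSum-split v L)) ⟩
      x * (x * G + nontrivialPart v L) + - (x * (x * G))    ≈⟨ +-congʳ (distribˡ x _ _) ⟩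
      (x * (x * G) + x * nontrivialPart v L) + - (x * (x * G)) ≈⟨ +-Comm.xy∙z≈y∙xz _ _ _ ⟩
      x * nontrivialPart v L + (x * (x * G) + - (x * (x * G))) ≈⟨ +-congˡ (-‿inverseʳ _) ⟩
      x * nontrivialPart v L + 0#                           ≈⟨ +-identityʳ _ ⟩
      x * nontrivialPart v L                                ∎)

  listSum : List A → A
  listSum = foldr _+_ 0#

  listSum-++ : ∀ as bs → listSum (as ++ bs) ≈ listSum as + listSum bs
  listSum-++ [] bs = sym (+-identityˡ _)
  listSum-++ (a ∷ as) bs = trans (+-congˡ (listSum-++ as bs)) (sym (+-assoc _ _ _))

  listSum-concat : ∀ {X : Set} (f : X → A) (xss : List (List X)) →
    listSum (map f (concat xss)) ≈ listSum (map (λ xs → listSum (map f xs)) xss)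
  listSum-concat f [] = refl
  listSum-concat f (xs ∷ xss) = trans (reflexive (P.cong listSum (LP.map-++ f xs (concat xss))))
    (trans (listSum-++ (map f xs) (map f (concat xss))) (+-congˡ (listSum-concat f xss)))

  listSum-applyUpTo : ∀ (g : ℕ → A) f n → listSum (map g (applyUpTo f n)) ≈ sumTo n (g ∘ f)
  listSum-applyUpTo g f zero = refl
  listSum-applyUpTo g f (suc n) = +-congˡ (listSum-applyUpTo g (f ∘ suc) n)

  listSum-cong : ∀ {X : Set} {f g : X → A} xs → (∀ z → f z ≈ g z) → listSum (map f xs) ≈ listSum (map g xs)
  listSum-cong [] f≈g = refl
  listSum-cong (z ∷ xs) f≈g = +-cong (f≈g z) (listSum-cong xs f≈g)

  ind-listSum : ∀ {X : Set} b c (h : X → A) xs → ind b (c * listSum (map h xs)) ≈ listSum (map (λ z → ind b (c * h z)) xs)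
  ind-listSum true c h [] = zeroʳ c
  ind-listSum true c h (z ∷ xs) = trans (distribˡ c _ _) (+-congˡ (ind-listSum true c h xs))
  ind-listSum false c h [] = refl
  ind-listSum false c h (z ∷ xs) = trans (sym (+-identityˡ 0#)) (+-congˡ (ind-listSum false c h xs))

  weight : List ℕ → A
  weight [] = 1#
  weight (m ∷ ms) = w m * weight ms

  collectionSum : List Vertex → List Vertex → A
  collectionSum E L = listSum (map (λ ms → ind (pairwiseDisjoint (pathsOf L ms) ∧ avoids (pathsOf L ms) E) (weight ms))
                                   (collectionsFor L))

  pathSum≈collectionSum : ∀ E L → pathSum E L ≈ collectionSum E L
  pathSum≈collectionSum E [] = sym (+-identityʳ _)
  pathSum≈collectionSum E (v ∷ L) = sym (begin
    listSum (map F (concat (map (λ m → map (m ∷_) (collectionsFor L)) (upTo (suc (level v))))))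
      ≈⟨ listSum-concat F (map (λ m → map (m ∷_) (collectionsFor L)) (upTo (suc (level v)))) ⟩
    listSum (map (λ mss → listSum (map F mss)) (map (λ m → map (m ∷_) (collectionsFor L)) (upTo (suc (level v)))))
      ≈⟨ reflexive (P.cong listSum (P.sym (LP.map-∘ (upTo (suc (level v)))))) ⟩
    listSum (map (λ m → listSum (map F (map (m ∷_) (collectionsFor L)))) (upTo (suc (level v))))
      ≈⟨ listSum-applyUpTo (λ m → listSum (map F (map (m ∷_) (collectionsFor L)))) id (suc (level v)) ⟩
    sumTo (suc (level v)) (λ m → listSum (map F (map (m ∷_) (collectionsFor L))))
      ≈⟨ sumTo-cong (suc (level v)) (λ m → sym (pathTerm≈ m)) ⟩
    pathSum E (v ∷ L) ∎)
    where
    F : List ℕ → A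
    F ms = ind (pairwiseDisjoint (pathsOf (v ∷ L) ms) ∧ avoids (pathsOf (v ∷ L) ms) E) (weight ms)
    pathTerm≈ : ∀ m → pathTerm E v L m ≈ listSum (map F (map (m ∷_) (collectionsFor L)))
    pathTerm≈ m = begin
      ind b (w m * pathSum (Pv ++ E) L)      ≈⟨ ind-cong b (*-congˡ (pathSum≈collectionSum (Pv ++ E) L)) ⟩
      ind b (w m * collectionSum (Pv ++ E) L) ≈⟨ ind-listSum b (w m) _ (collectionsFor L) ⟩
      listSum (map (λ ms → ind b (w m * ind (pairwiseDisjoint (pathsOf L ms) ∧ avoids (pathsOf L ms) (Pv ++ E)) (weight ms)))
                   (collectionsFor L))
        ≈⟨ listSum-cong (collectionsFor L) (λ ms → trans (ind-∧ b _ (w m) (weight ms))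
             (reflexive (P.cong (λ t → ind t (w m * weight ms)) (disjoint-cons Pv (pathsOf L ms) E)))) ⟩
      listSum (map (F ∘ (m ∷_)) (collectionsFor L)) ≈⟨ reflexive (P.cong listSum (LP.map-∘ (collectionsFor L))) ⟩
      listSum (map F (map (m ∷_) (collectionsFor L))) ∎
      where
      Pv = edgesOfPath v m
      b = not (shareEdge Pv E)

  pathSum-explicit : ∀ L → pathSum [] L ≈
    listSum (map (λ ms → ind (pairwiseDisjoint (pathsOf L ms)) (weight ms)) (collectionsFor L))
  pathSum-explicit L = trans (pathSum≈collectionSum [] L) (listSum-cong (collectionsFor L) (λ ms →
    reflexive (P.cong (λ b → ind b (weight ms))
      (P.trans (P.cong (pairwiseDisjoint (pathsOf L ms) ∧_) (avoids-[] (pathsOf L ms))) (BP.∧-identityʳ _)))))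

-- Induction on the total size of
-- the family, reducing at a deepest vertex v = V k:
--   * v is the root: both sides are x times the value without v;
--   * nobody else lies below v: move v to its parent (Rule 2);
--   * some other vertex lies below v: being deepest, it is a copy of v (Rule 3).
module PencilDeterminant (R : CommutativeRing 0ℓ 0ℓ) (x y : CommutativeRing.Carrier R) where

  open import Defs using (Vertex)
  open Ancestry
  open import Data.Nat using (ℕ; zero; suc; _≤_; _<_; z≤n; s≤s)
  import Data.Nat.Properties as ℕP
  open import Data.Nat.ListAction using (sum)
  open import Data.Nat.ListAction.Properties using (sum-↭)
  open import Data.Fin as Fin using (Fin; punchIn)
  import Data.Fin.Properties as FP
  open import Data.List using (List; []; _∷_; length; map; tabulate)
  import Data.List.Properties as LP
  import Data.List.Relation.Unary.All.Properties as AllP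
  open import Data.List.Relation.Binary.Permutation.Propositional as Perm using (_↭_; ↭-sym; ↭-trans)
  open import Data.List.Relation.Binary.Permutation.Propositional.Properties using (drop-∷; map⁺)
  open import Data.Product using (Σ; _,_)
  open import Relation.Nullary using (yes; no; ¬_)
  open import Relation.Binary.PropositionalEquality as P using (_≡_)
  open import Function using (_∘_)

  open CommutativeRing R renaming (Carrier to A)
  open import Relation.Binary.Reasoning.Setoid setoid
  open Determinant R using (det; partner; partner-back)
  open AncestralPencil R x y
  open PathSum R x y using (pathSum; pathSum-perm; pathSum-root; pathSum-privateEdge; pathSum-repeated)

  tabulate-pick : ∀ {n} (V : Fin (suc n) → Vertex) k → tabulate V ↭ V k ∷ tabulate (V ∘ punchIn k)
  tabulate-pick V Fin.zero = Perm.refl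
  tabulate-pick {suc n} V (Fin.suc k) =
    ↭-trans (Perm.prep (V Fin.zero) (tabulate-pick (V ∘ Fin.suc) k)) (Perm.swap (V Fin.zero) (V (Fin.suc k)) Perm.refl)

  tabulate-setVertex : ∀ {n} (V : Fin (suc n) → Vertex) k p → tabulate (setVertex V k p) ↭ p ∷ tabulate (V ∘ punchIn k)
  tabulate-setVertex V k p = P.subst₂ (λ z zs → tabulate (setVertex V k p) ↭ z ∷ zs)
    (setVertex-k V k p) (LP.tabulate-cong (setVertex-off V k p)) (tabulate-pick (setVertex V k p) k)

  pathSum-pick : ∀ {n} (V : Fin (suc n) → Vertex) k {v} → V k ≡ v →
                 pathSum [] (tabulate V) ≈ pathSum [] (v ∷ tabulate (V ∘ punchIn k))
  pathSum-pick V k P.refl = pathSum-perm (tabulate-pick V k) []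

  size : List Vertex → ℕ
  size L = sum (map (suc ∘ length) L)

  size-↭ : ∀ {L L′} → L ↭ L′ → size L ≡ size L′
  size-↭ L↭L′ = sum-↭ (map⁺ (suc ∘ length) L↭L′)

  size-remove : ∀ {n} (V : Fin (suc n) → Vertex) k → size (tabulate (V ∘ punchIn k)) < size (tabulate V)
  size-remove V k = P.subst (size (tabulate (V ∘ punchIn k)) <_) (P.sym (size-↭ (tabulate-pick V k))) (ℕP.m<n+m _ (s≤s z≤n))

  size-setVertex : ∀ {n} (V : Fin (suc n) → Vertex) k p → length p < length (V k) →
                   size (tabulate (setVertex V k p)) < size (tabulate V)
  size-setVertex V k p shorter = P.subst₂ _<_ (P.sym (size-↭ (tabulate-setVertex V k p))) (P.sym (size-↭ (tabulate-pick V k)))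
                                          (ℕP.+-monoˡ-< _ (s≤s shorter))

  deepest : ∀ {n} (V : Fin (suc n) → Vertex) → Σ (Fin (suc n)) (λ k → ∀ j → length (V j) ≤ length (V k))
  deepest {zero} V = Fin.zero , λ { Fin.zero → ℕP.≤-refl }
  deepest {suc n} V with deepest (V ∘ Fin.suc)
  ... | k , k-deepest with length (V Fin.zero) ℕP.≤? length (V (Fin.suc k))
  ... | yes le = Fin.suc k , λ { Fin.zero → le ; (Fin.suc j) → k-deepest j }
  ... | no gt = Fin.zero , λ { Fin.zero → ℕP.≤-refl ; (Fin.suc j) → ℕP.≤-trans (k-deepest j) (ℕP.<⇒≤ (ℕP.≰⇒> gt)) }

  Claim : ℕ → Set
  Claim b = ∀ {n} (V : Fin n → Vertex) → size (tabulate V) < b → det (pencil V) ≈ pathSum [] (tabulate V)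

  claim-root : ∀ {b n} → Claim b → (V : Fin (suc n) → Vertex) (k : Fin (suc n)) → size (tabulate V) ≤ b → V k ≡ [] →
               det (pencil V) ≈ pathSum [] (tabulate V)
  claim-root claim V k bound Vk≡root = begin
    det (pencil V)                                     ≈⟨ det-rootVertex V k Vk≡root ⟩
    x * det (pencil (V ∘ punchIn k))                   ≈⟨ *-congˡ (claim (V ∘ punchIn k) (ℕP.<-≤-trans (size-remove V k) bound)) ⟩
    x * pathSum [] (tabulate (V ∘ punchIn k))          ≈⟨ sym (pathSum-root [] (tabulate (V ∘ punchIn k))) ⟩
    pathSum [] ([] ∷ tabulate (V ∘ punchIn k))         ≈⟨ sym (pathSum-pick V k Vk≡root) ⟩
    pathSum [] (tabulate V)                            ∎

  claim-privateEdge : ∀ {b n} → Claim b → (V : Fin (suc n) → Vertex) (k : Fin (suc n)) → size (tabulate V) ≤ b →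
    ∀ a u → V k ≡ a ∷ u → (∀ i → ¬ (a ∷ u) ≼ V (punchIn k i)) → det (pencil V) ≈ pathSum [] (tabulate V)
  claim-privateEdge claim V k bound a u Vk≡v v-private = begin
    det (pencil V)
      ≈⟨ det-privateEdge V k a u Vk≡v v-private ⟩
    det (pencil V′) + y * det (pencil (V ∘ punchIn k))
      ≈⟨ +-cong (claim V′ (ℕP.<-≤-trans (size-setVertex V k p shorter) bound))
                (*-congˡ (claim (V ∘ punchIn k) (ℕP.<-≤-trans (size-remove V k) bound))) ⟩
    pathSum [] (tabulate V′) + y * pathSum [] rest
      ≈⟨ +-congʳ (pathSum-perm (tabulate-setVertex V k p) []) ⟩
    pathSum [] (p ∷ rest) + y * pathSum [] rest
      ≈⟨ sym (pathSum-privateEdge a u rest (AllP.tabulate⁺ v-private)) ⟩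
    pathSum [] ((a ∷ u) ∷ rest)
      ≈⟨ sym (pathSum-pick V k Vk≡v) ⟩
    pathSum [] (tabulate V) ∎
    where
    p = parent (a ∷ u)
    V′ = setVertex V k p
    rest = tabulate (V ∘ punchIn k)
    shorter : length p < length (V k)
    shorter = P.subst (λ z → length p < length z) (P.sym Vk≡v) (P.subst (length p <_) (P.sym (level-parent a u)) (ℕP.n<1+n _))

  claim-repeated : ∀ {b n} → Claim b → (V : Fin (suc n) → Vertex) (k : Fin (suc n)) → size (tabulate V) ≤ b →
    ∀ a u → (∀ j → length (V j) ≤ length (a ∷ u)) → V k ≡ a ∷ u → ∀ i → (a ∷ u) ≼ V (punchIn k i) →
    det (pencil V) ≈ pathSum [] (tabulate V)
  claim-repeated {n = suc n} claim V k bound a u v-deepest Vk≡v i v≼Vm = begin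
    det (pencil V)
      ≈⟨ det-repeatedVertex V k i (P.trans Vk≡v (P.sym Vm≡v)) ⟩
    x * det (pencil (V ∘ punchIn k)) + (x * det (pencil (V ∘ punchIn m)) + - (x * (x * det (pencil (V ∘ punchIn m ∘ punchIn k′)))))
      ≈⟨ +-cong (*-congˡ (claim (V ∘ punchIn k) (ℕP.<-≤-trans (size-remove V k) bound)))
                (+-cong (*-congˡ (claim (V ∘ punchIn m) (ℕP.<-≤-trans (size-remove V m) bound)))
                        (-‿cong (*-congˡ (*-congˡ (claim (V ∘ punchIn m ∘ punchIn k′)
                          (ℕP.<-≤-trans (ℕP.<-trans (size-remove (V ∘ punchIn m) k′) (size-remove V m)) bound)))))) ⟩
    x * pathSum [] (tabulate (V ∘ punchIn k)) + (x * pathSum [] (tabulate (V ∘ punchIn m)) + - (x * (x * pathSum [] rest)))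
      ≈⟨ +-cong (*-congˡ (pathSum-perm without-k [])) (+-congʳ (*-congˡ (pathSum-perm without-m []))) ⟩
    x * pathSum [] (v ∷ rest) + (x * pathSum [] (v ∷ rest) + - (x * (x * pathSum [] rest)))
      ≈⟨ sym (pathSum-repeated a u rest) ⟩
    pathSum [] (v ∷ v ∷ rest)
      ≈⟨ sym (pathSum-perm both []) ⟩
    pathSum [] (tabulate V) ∎
    where
    v = a ∷ u
    m = punchIn k i
    k′ = partner k i
    rest = tabulate (V ∘ punchIn m ∘ punchIn k′)
    -- the deeper vertex V m below v is as deep as v, hence equal to v
    Vm≡v : V m ≡ v
    Vm≡v = ≼-deepest v≼Vm (v-deepest m)
    without-m : tabulate (V ∘ punchIn m) ↭ v ∷ rest
    without-m = P.subst (λ z → tabulate (V ∘ punchIn m) ↭ z ∷ rest) (P.trans (P.cong V (partner-back k i)) Vk≡v)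
                        (tabulate-pick (V ∘ punchIn m) k′)
    both : tabulate V ↭ v ∷ v ∷ rest
    both = ↭-trans (P.subst (λ z → tabulate V ↭ z ∷ tabulate (V ∘ punchIn m)) Vm≡v (tabulate-pick V m)) (Perm.prep v without-m)
    without-k : tabulate (V ∘ punchIn k) ↭ v ∷ rest
    without-k = drop-∷ (↭-trans (↭-sym (P.subst (λ z → tabulate V ↭ z ∷ tabulate (V ∘ punchIn k)) Vk≡v (tabulate-pick V k)))
                                both)

  claim : ∀ b → Claim b
  claim zero V ()
  claim (suc b) {zero} V _ = refl
  claim (suc b) {suc n} V (s≤s bound) with deepest V
  ... | k , k-deepest with V k in Vk≡
  ... | [] = claim-root (claim b) V k bound Vk≡
  ... | a ∷ u with FP.any? (λ i → (a ∷ u) ≼? V (punchIn k i))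
  ...   | no none-below = claim-privateEdge (claim b) V k bound a u Vk≡ (λ i below → none-below (i , below))
  ...   | yes (i , below) = claim-repeated (claim b) V k bound a u k-deepest Vk≡ i below

  det-pencil : ∀ {n} (V : Fin n → Vertex) → det (pencil V) ≈ pathSum [] (tabulate V)
  det-pencil V = claim (suc (size (tabulate V))) V ℕP.≤-refl

module PolynomialRing where

  open import Defs
  open import Data.Nat using (ℕ; zero; suc)
  open import Data.Integer as ℤ using (ℤ; 0ℤ; 1ℤ)
  import Data.Integer.Properties as ℤP
  open import Data.Integer.Tactic.RingSolver using (solve-∀)
  open import Data.List using ([]; _∷_)
  open import Data.Product using (_,_)
  open import Relation.Binary.PropositionalEquality

  infix 4 _≈P_
  record _≈P_ (p q : Poly) : Set where
    constructor mk
    field coeff-≡ : ∀ k → coeff k p ≡ coeff k q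
  open _≈P_ public

  coeff-+P : ∀ k p q → coeff k (p +P q) ≡ coeff k p ℤ.+ coeff k q
  coeff-+P k [] q = sym (ℤP.+-identityˡ (coeff k q))
  coeff-+P k (a ∷ p) [] = sym (ℤP.+-identityʳ (coeff k (a ∷ p)))
  coeff-+P zero (a ∷ p) (b ∷ q) = refl
  coeff-+P (suc k) (a ∷ p) (b ∷ q) = coeff-+P k p q

  coeff-scaleP : ∀ k a p → coeff k (scaleP a p) ≡ a ℤ.* coeff k p
  coeff-scaleP k a [] = sym (ℤP.*-zeroʳ a)
  coeff-scaleP zero a (b ∷ p) = refl
  coeff-scaleP (suc k) a (b ∷ p) = coeff-scaleP k a p

  coeff--P : ∀ k p → coeff k (-P p) ≡ ℤ.- coeff k p
  coeff--P k [] = refl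
  coeff--P zero (a ∷ p) = refl
  coeff--P (suc k) (a ∷ p) = coeff--P k p

  shifted : ℕ → Poly → ℤ
  shifted zero p = 0ℤ
  shifted (suc k) p = coeff k p

  coeff-shift : ∀ k p → coeff k (0ℤ ∷ p) ≡ shifted k p
  coeff-shift zero p = refl
  coeff-shift (suc k) p = refl

  shifted-cong : ∀ {p q} → p ≈P q → ∀ k → shifted k p ≡ shifted k q
  shifted-cong p≈q zero = refl
  shifted-cong p≈q (suc k) = coeff-≡ p≈q k

  shifted-[] : ∀ k → shifted k [] ≡ 0ℤ
  shifted-[] zero = refl
  shifted-[] (suc k) = refl

  coeff-*P : ∀ k a p q → coeff k ((a ∷ p) *P q) ≡ a ℤ.* coeff k q ℤ.+ shifted k (p *P q)
  coeff-*P k a p q = trans (coeff-+P k (scaleP a q) (0ℤ ∷ (p *P q))) (cong₂ ℤ._+_ (coeff-scaleP k a q) (coeff-shift k (p *P q)))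

  coeff-constP*P : ∀ k c p → coeff k (constP c *P p) ≡ c ℤ.* coeff k p
  coeff-constP*P k c p = trans (coeff-*P k c [] p) (trans (cong (λ s → c ℤ.* coeff k p ℤ.+ s) (shifted-[] k)) (ℤP.+-identityʳ _))

  coeff-X*P-zero : ∀ p → coeff 0 (X *P p) ≡ 0ℤ
  coeff-X*P-zero p = trans (coeff-*P 0 0ℤ (1ℤ ∷ []) p) (trans (ℤP.+-identityʳ _) (ℤP.*-zeroˡ (coeff 0 p)))

  coeff-X*P : ∀ k p → coeff (suc k) (X *P p) ≡ coeff k p
  coeff-X*P k p = trans (coeff-*P (suc k) 0ℤ (1ℤ ∷ []) p)
    (trans (cong₂ ℤ._+_ (ℤP.*-zeroˡ (coeff (suc k) p)) (coeff-constP*P k 1ℤ p))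
           (trans (ℤP.+-identityˡ _) (ℤP.*-identityˡ (coeff k p))))

  ≈P-refl : ∀ {p} → p ≈P p
  ≈P-refl = mk (λ k → refl)

  ≈P-sym : ∀ {p q} → p ≈P q → q ≈P p
  ≈P-sym p≈q = mk (λ k → sym (coeff-≡ p≈q k))

  ≈P-trans : ∀ {p q r} → p ≈P q → q ≈P r → p ≈P r
  ≈P-trans p≈q q≈r = mk (λ k → trans (coeff-≡ p≈q k) (coeff-≡ q≈r k))

  +P-cong : ∀ {p p′ q q′} → p ≈P p′ → q ≈P q′ → (p +P q) ≈P (p′ +P q′)
  +P-cong {p} {p′} {q} {q′} p≈p′ q≈q′ =
    mk (λ k → trans (coeff-+P k p q) (trans (cong₂ ℤ._+_ (coeff-≡ p≈p′ k) (coeff-≡ q≈q′ k)) (sym (coeff-+P k p′ q′))))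

  -P-cong : ∀ {p q} → p ≈P q → (-P p) ≈P (-P q)
  -P-cong {p} {q} p≈q = mk (λ k → trans (coeff--P k p) (trans (cong ℤ.-_ (coeff-≡ p≈q k)) (sym (coeff--P k q))))

  +P-assoc : ∀ p q r → ((p +P q) +P r) ≈P (p +P (q +P r))
  +P-assoc p q r = mk λ k → trans (coeff-+P k (p +P q) r) (trans (cong (ℤ._+ coeff k r) (coeff-+P k p q))
    (trans (ℤP.+-assoc (coeff k p) (coeff k q) (coeff k r))
           (sym (trans (coeff-+P k p (q +P r)) (cong (λ c → coeff k p ℤ.+ c) (coeff-+P k q r))))))

  +P-comm : ∀ p q → (p +P q) ≈P (q +P p)
  +P-comm p q = mk (λ k → trans (coeff-+P k p q) (trans (ℤP.+-comm (coeff k p) (coeff k q)) (sym (coeff-+P k q p))))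

  +P-identityʳ : ∀ p → (p +P []) ≈P p
  +P-identityʳ p = mk (λ k → trans (coeff-+P k p []) (ℤP.+-identityʳ (coeff k p)))

  -P-inverseˡ : ∀ p → ((-P p) +P p) ≈P []
  -P-inverseˡ p = mk (λ k → trans (coeff-+P k (-P p) p) (trans (cong (ℤ._+ coeff k p) (coeff--P k p)) (ℤP.+-inverseˡ (coeff k p))))

  -P-inverseʳ : ∀ p → (p +P (-P p)) ≈P []
  -P-inverseʳ p = mk (λ k → trans (coeff-+P k p (-P p)) (trans (cong (λ c → coeff k p ℤ.+ c) (coeff--P k p)) (ℤP.+-inverseʳ (coeff k p))))

  cons-cong : ∀ a {p q} → p ≈P q → (a ∷ p) ≈P (a ∷ q)
  cons-cong a p≈q = mk (λ { zero → refl ; (suc k) → coeff-≡ p≈q k })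

  *P-zeroˡ : ∀ p q → p ≈P [] → (p *P q) ≈P []
  *P-zeroˡ [] q _ = ≈P-refl
  *P-zeroˡ (a ∷ p) q p≈0 = mk λ k → trans (coeff-*P k a p q)
    (trans (cong₂ ℤ._+_ (trans (cong (ℤ._* coeff k q) (coeff-≡ p≈0 0)) (ℤP.*-zeroˡ (coeff k q)))
                        (shifted-cong (*P-zeroˡ p q (mk (λ j → coeff-≡ p≈0 (suc j)))) k))
           (trans (ℤP.+-identityˡ _) (shifted-[] k)))

  *P-congˡ : ∀ {p p′} q → p ≈P p′ → (p *P q) ≈P (p′ *P q)
  *P-congˡ {[]} {[]} q _ = ≈P-refl
  *P-congˡ {[]} {a′ ∷ p′} q p≈p′ = ≈P-sym (*P-zeroˡ (a′ ∷ p′) q (≈P-sym p≈p′))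
  *P-congˡ {a ∷ p} {[]} q p≈p′ = *P-zeroˡ (a ∷ p) q p≈p′
  *P-congˡ {a ∷ p} {a′ ∷ p′} q p≈p′ = mk λ k → trans (coeff-*P k a p q)
    (trans (cong₂ (λ u v → u ℤ.* coeff k q ℤ.+ v) (coeff-≡ p≈p′ 0) (shifted-cong (*P-congˡ {p} {p′} q (mk (λ j → coeff-≡ p≈p′ (suc j)))) k))
           (sym (coeff-*P k a′ p′ q)))

  *P-congʳ : ∀ p {q q′} → q ≈P q′ → (p *P q) ≈P (p *P q′)
  *P-congʳ [] _ = ≈P-refl
  *P-congʳ (a ∷ p) {q} {q′} q≈q′ = mk λ k → trans (coeff-*P k a p q)
    (trans (cong₂ (λ u v → a ℤ.* u ℤ.+ v) (coeff-≡ q≈q′ k) (shifted-cong (*P-congʳ p q≈q′) k)) (sym (coeff-*P k a p q′)))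

  *P-zeroʳ : ∀ p → (p *P []) ≈P []
  *P-zeroʳ [] = ≈P-refl
  *P-zeroʳ (a ∷ p) = mk λ k → trans (coeff-*P k a p [])
    (trans (cong (λ c → a ℤ.* coeff k [] ℤ.+ c) (trans (shifted-cong (*P-zeroʳ p) k) (shifted-[] k)))
           (trans (ℤP.+-identityʳ _) (ℤP.*-zeroʳ a)))

  *P-identityˡ : ∀ p → (constP 1ℤ *P p) ≈P p
  *P-identityˡ p = mk λ k → trans (coeff-constP*P k 1ℤ p) (ℤP.*-identityˡ _)

  *P-distribʳ : ∀ p q r → ((q +P r) *P p) ≈P ((q *P p) +P (r *P p))
  *P-distribʳ p [] r = ≈P-refl
  *P-distribʳ p (a ∷ q) [] = ≈P-sym (+P-identityʳ ((a ∷ q) *P p))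
  *P-distribʳ p (a ∷ q) (b ∷ r) = mk λ k →
    trans (coeff-*P k (a ℤ.+ b) (q +P r) p) (trans (cong (λ c → (a ℤ.+ b) ℤ.* coeff k p ℤ.+ c) (shifted-+ k))
      (trans (regroup a b (coeff k p) (shifted k (q *P p)) (shifted k (r *P p)))
        (sym (trans (coeff-+P k ((a ∷ q) *P p) ((b ∷ r) *P p)) (cong₂ ℤ._+_ (coeff-*P k a q p) (coeff-*P k b r p))))))
    where
    regroup : ∀ a b c s t → (a ℤ.+ b) ℤ.* c ℤ.+ (s ℤ.+ t) ≡ (a ℤ.* c ℤ.+ s) ℤ.+ (b ℤ.* c ℤ.+ t)
    regroup = solve-∀
    shifted-+ : ∀ k → shifted k ((q +P r) *P p) ≡ shifted k (q *P p) ℤ.+ shifted k (r *P p)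
    shifted-+ zero = refl
    shifted-+ (suc k) = trans (coeff-≡ (*P-distribʳ p q r) k) (coeff-+P k (q *P p) (r *P p))

  *P-cons : ∀ p b q → (p *P (b ∷ q)) ≈P (scaleP b p +P (0ℤ ∷ (p *P q)))
  *P-cons [] b q = mk (λ { zero → refl ; (suc k) → refl })
  *P-cons (a ∷ p) b q = mk coeffs
    where
    swap-middle : ∀ aq bp z → aq ℤ.+ (bp ℤ.+ z) ≡ bp ℤ.+ (aq ℤ.+ z)
    swap-middle = solve-∀
    coeffs : ∀ k → coeff k ((a ∷ p) *P (b ∷ q)) ≡ coeff k (scaleP b (a ∷ p) +P (0ℤ ∷ ((a ∷ p) *P q)))
    coeffs zero = cong (ℤ._+ 0ℤ) (ℤP.*-comm a b)
    coeffs (suc k) =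
      trans (coeff-+P k (scaleP a q) (p *P (b ∷ q)))
      (trans (cong₂ ℤ._+_ (coeff-scaleP k a q) (trans (coeff-≡ (*P-cons p b q) k)
               (trans (coeff-+P k (scaleP b p) (0ℤ ∷ (p *P q))) (cong₂ ℤ._+_ (coeff-scaleP k b p) (coeff-shift k (p *P q))))))
      (trans (swap-middle (a ℤ.* coeff k q) (b ℤ.* coeff k p) (shifted k (p *P q)))
      (sym (trans (coeff-+P k (scaleP b p) ((a ∷ p) *P q)) (cong₂ ℤ._+_ (coeff-scaleP k b p) (coeff-*P k a p q))))))

  *P-comm : ∀ p q → (p *P q) ≈P (q *P p)
  *P-comm [] q = ≈P-sym (*P-zeroʳ q)
  *P-comm (a ∷ p) q = ≈P-trans (+P-cong (≈P-refl {scaleP a q}) (cons-cong 0ℤ (*P-comm p q))) (≈P-sym (*P-cons q a p))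

  scaleP-*P : ∀ a q r → (scaleP a q *P r) ≈P scaleP a (q *P r)
  scaleP-*P a [] r = ≈P-refl
  scaleP-*P a (b ∷ q) r = mk λ k →
    trans (coeff-*P k (a ℤ.* b) (scaleP a q) r)
    (trans (cong (λ c → (a ℤ.* b) ℤ.* coeff k r ℤ.+ c) (trans (shifted-cong (scaleP-*P a q r) k) (shifted-scaleP k)))
    (trans (factor a b (coeff k r) (shifted k (q *P r)))
    (sym (trans (coeff-scaleP k a ((b ∷ q) *P r)) (cong (a ℤ.*_) (coeff-*P k b q r))))))
    where
    factor : ∀ a b c z → (a ℤ.* b) ℤ.* c ℤ.+ a ℤ.* z ≡ a ℤ.* (b ℤ.* c ℤ.+ z)
    factor = solve-∀
    shifted-scaleP : ∀ k → shifted k (scaleP a (q *P r)) ≡ a ℤ.* shifted k (q *P r)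
    shifted-scaleP zero = sym (ℤP.*-zeroʳ a)
    shifted-scaleP (suc k) = coeff-scaleP k a (q *P r)

  shift-*P : ∀ s r → ((0ℤ ∷ s) *P r) ≈P (0ℤ ∷ (s *P r))
  shift-*P s r = mk λ k → trans (coeff-*P k 0ℤ s r)
    (trans (cong (ℤ._+ shifted k (s *P r)) (ℤP.*-zeroˡ (coeff k r))) (trans (ℤP.+-identityˡ _) (sym (coeff-shift k (s *P r)))))

  *P-assoc : ∀ p q r → ((p *P q) *P r) ≈P (p *P (q *P r))
  *P-assoc [] q r = ≈P-refl
  *P-assoc (a ∷ p) q r =
    ≈P-trans (*P-distribʳ r (scaleP a q) (0ℤ ∷ (p *P q)))
             (+P-cong (scaleP-*P a q r) (≈P-trans (shift-*P (p *P q) r) (cons-cong 0ℤ (*P-assoc p q r))))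

  open import Algebra.Structures _≈P_ using (IsCommutativeRing)

  Poly-isCommutativeRing : IsCommutativeRing _+P_ _*P_ -P_ [] (constP 1ℤ)
  Poly-isCommutativeRing = record
    { isRing = record
      { +-isAbelianGroup = record
        { isGroup = record
          { isMonoid = record
            { isSemigroup = record
              { isMagma = record { isEquivalence = record { refl = ≈P-refl ; sym = ≈P-sym ; trans = ≈P-trans } ; ∙-cong = +P-cong }
              ; assoc = +P-assoc }
            ; identity = (λ p → ≈P-refl) , +P-identityʳ }
          ; inverse = -P-inverseˡ , -P-inverseʳ
          ; ⁻¹-cong = -P-cong }
        ; comm = +P-comm }
      ; *-cong = λ {p} {p′} {q} {q′} p≈p′ q≈q′ → ≈P-trans (*P-congˡ q p≈p′) (*P-congʳ p′ q≈q′)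
      ; *-assoc = *P-assoc
      ; *-identity = *P-identityˡ , (λ p → ≈P-trans (*P-comm p (constP 1ℤ)) (*P-identityˡ p))
      ; distrib = (λ p q r → ≈P-trans (*P-comm p (q +P r)) (≈P-trans (*P-distribʳ p q r) (+P-cong (*P-comm q p) (*P-comm r p))))
                , *P-distribʳ }
    ; *-comm = *P-comm }

  Poly-commutativeRing : CommutativeRing 0ℓ 0ℓ
  Poly-commutativeRing = record { isCommutativeRing = Poly-isCommutativeRing }

module Counting where

  open import Defs
  open import Data.Nat as ℕ using (zero; suc; _≤_)
  import Data.Nat.Properties as ℕP
  open import Data.Integer as ℤ using (ℤ; +_; 0ℤ)
  import Data.Integer.Properties as ℤP
  open import Data.List using (List; []; _∷_; length; map; filter; foldr; upTo)
  open import Data.List.Relation.Unary.All as All using (All; []; _∷_)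
  import Data.List.Relation.Unary.All.Properties as AllP
  open import Data.Bool using (Bool; true; false; if_then_else_)
  open import Data.Bool.Properties using (T?)
  open import Relation.Binary.PropositionalEquality

  zsum : List ℤ → ℤ
  zsum = foldr ℤ._+_ 0ℤ

  count-indicator : ∀ {X : Set} (b : X → Bool) c xs →
    zsum (map (λ z → if b z then c else 0ℤ) xs) ≡ c ℤ.* + length (filter (λ z → T? (b z)) xs)
  count-indicator b c [] = sym (ℤP.*-zeroʳ c)
  count-indicator b c (z ∷ xs) with b z
  ... | true = trans (cong (λ s → c ℤ.+ s) (count-indicator b c xs)) (sym (ℤP.*-suc c _))
  ... | false = trans (ℤP.+-identityˡ _) (count-indicator b c xs)

  collectionsFor-length : ∀ L → All (λ ms → length ms ≡ length L) (collectionsFor L)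
  collectionsFor-length [] = refl ∷ []
  collectionsFor-length (v ∷ L) =
    AllP.concat⁺ (AllP.map⁺ (All.universal (λ m → AllP.map⁺ (All.map (cong suc) (collectionsFor-length L))) (upTo (suc (level v)))))

  numNonTrivial≤length : ∀ ms → numNonTrivial ms ≤ length ms
  numNonTrivial≤length [] = ℕ.z≤n
  numNonTrivial≤length (zero ∷ ms) = ℕP.m≤n⇒m≤1+n (numNonTrivial≤length ms)
  numNonTrivial≤length (suc m ∷ ms) = ℕ.s≤s (numNonTrivial≤length ms)

-- x = y = 1 over ℤ: the pencil is I + C(T) and every collection has weight 1.
module IdentityPlusAncestral where

  open import Defs
  open import Data.Nat using (zero; suc)
  open import Data.Integer as ℤ using (+_; 0ℤ; 1ℤ)
  import Data.Integer.Properties as ℤP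
  open import Data.List using ([]; _∷_; map; tabulate)
  import Data.List.Properties as LP
  open import Data.Bool using (if_then_else_)
  open import Relation.Binary.PropositionalEquality
  open Counting

  open Determinant ℤP.+-*-commutativeRing using (det; det-cong)
  open AncestralPencil ℤP.+-*-commutativeRing 1ℤ 1ℤ using (pencil; ι)
  open PathSum ℤP.+-*-commutativeRing 1ℤ 1ℤ using (weight; pathSum; pathSum-explicit)
  open PencilDeterminant ℤP.+-*-commutativeRing 1ℤ 1ℤ using (det-pencil)

  ι≡ : ∀ n → ι n ≡ + n
  ι≡ zero = refl
  ι≡ (suc n) = cong (λ z → 1ℤ ℤ.+ z) (ι≡ n)

  weight≡1 : ∀ ms → weight ms ≡ 1ℤ
  weight≡1 [] = refl
  weight≡1 (zero ∷ ms) = cong (λ z → 1ℤ ℤ.* z) (weight≡1 ms)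
  weight≡1 (suc m ∷ ms) = cong (λ z → 1ℤ ℤ.* z) (weight≡1 ms)

  I+C≡pencil : ∀ T i j → IplusC T i j ≡ pencil (leaf T) i j
  I+C≡pencil T i j = cong (λ c → (if δ i j then 1ℤ else 0ℤ) ℤ.+ c)
                          (sym (trans (ℤP.*-identityˡ _) (ι≡ (level (leaf T i ∨v leaf T j)))))

  det-I+C : ∀ T → DetZ.det (IplusC T) ≡ + countAll T
  det-I+C T = begin
    DetZ.det (IplusC T)      ≡⟨ det-cong {numLeaves T} (I+C≡pencil T) ⟩
    det (pencil (leaf T))    ≡⟨ det-pencil (leaf T) ⟩
    pathSum [] (tabulate (leaf T))
      ≡⟨ cong (pathSum []) (LP.tabulate-lookup (leaves T)) ⟩
    pathSum [] (leaves T)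
      ≡⟨ pathSum-explicit (leaves T) ⟩
    zsum (map (λ ms → if edgeDisjoint T ms then weight ms else 0ℤ) (collections T))
      ≡⟨ cong zsum (LP.map-cong (λ ms → cong (λ w → if edgeDisjoint T ms then w else 0ℤ) (weight≡1 ms)) (collections T)) ⟩
    zsum (map (λ ms → if edgeDisjoint T ms then 1ℤ else 0ℤ) (collections T))
      ≡⟨ count-indicator (edgeDisjoint T) 1ℤ (collections T) ⟩
    1ℤ ℤ.* + countAll T      ≡⟨ ℤP.*-identityˡ _ ⟩
    + countAll T             ∎
    where open ≡-Reasoning

-- x = X, y = −1 over ℤ[X]: the pencil is XI − C(T), and a collection with
-- j trivial and i non-trivial paths has weight (−1)^i X^j.
module CharacteristicPolynomial where

  open import Defs
  open import Data.Nat as ℕ using (zero; suc; _≤_; _∸_)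
  import Data.Nat.Properties as ℕP
  open import Data.Integer as ℤ using (+_; 0ℤ; 1ℤ; -1ℤ; _^_)
  import Data.Integer.Properties as ℤP
  open import Data.List using (List; []; _∷_; length; map; foldr; tabulate)
  import Data.List.Properties as LP
  import Data.List.Relation.Unary.All as All
  open import Data.Bool using (true; false; if_then_else_; _∧_)
  open import Relation.Binary.PropositionalEquality
  open BooleanEquality
  open Counting
  open PolynomialRing

  -1P : Poly
  -1P = constP -1ℤ

  open Determinant Poly-commutativeRing using (det; det-cong)
  open AncestralPencil Poly-commutativeRing X -1P using (pencil; ι)
  open PathSum Poly-commutativeRing X -1P using (weight; pathSum; pathSum-explicit)
  open PencilDeterminant Poly-commutativeRing X -1P using (det-pencil)

  ι≈ : ∀ n → ι n ≈P constP (+ n)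
  ι≈ zero = mk (λ { zero → refl ; (suc k) → refl })
  ι≈ (suc n) = mk coeffs
    where
    coeffs : ∀ k → coeff k (constP 1ℤ +P ι n) ≡ coeff k (constP (+ suc n))
    coeffs zero = trans (coeff-+P 0 (constP 1ℤ) (ι n)) (cong (λ c → 1ℤ ℤ.+ c) (coeff-≡ (ι≈ n) 0))
    coeffs (suc k) = trans (coeff-+P (suc k) (constP 1ℤ) (ι n)) (trans (ℤP.+-identityˡ _) (coeff-≡ (ι≈ n) (suc k)))

  -1P-*P : ∀ c → (-1P *P constP c) ≈P (-P constP c)
  -1P-*P c = mk λ k → trans (coeff-constP*P k -1ℤ (constP c)) (trans (ℤP.-1*i≡-i (coeff k (constP c))) (sym (coeff--P k (constP c))))

  pencil≈ : ∀ T i j → ((if δ i j then X else []) +P (-P constP (C T i j))) ≈P pencil (leaf T) i j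
  pencil≈ T i j = +P-cong ≈P-refl (≈P-sym (≈P-trans (*P-congʳ -1P (ι≈ (level (leaf T i ∨v leaf T j))))
                                                  (-1P-*P (+ level (leaf T i ∨v leaf T j)))))

  polySum : List Poly → Poly
  polySum = foldr _+P_ []

  Γ≈ : ∀ T → Γ T ≈P polySum (map (λ ms → if edgeDisjoint T ms then weight ms else []) (collections T))
  Γ≈ T = ≈P-trans (det-cong {numLeaves T} (pencil≈ T))
         (≈P-trans (det-pencil (leaf T))
         (≈P-trans (subst (λ L → pathSum [] (tabulate (leaf T)) ≈P pathSum [] L) (LP.tabulate-lookup (leaves T)) ≈P-refl)
                   (pathSum-explicit (leaves T))))

  coeff-polySum : ∀ {Z : Set} (f : Z → Poly) j xs → coeff j (polySum (map f xs)) ≡ zsum (map (λ z → coeff j (f z)) xs)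
  coeff-polySum f j [] = refl
  coeff-polySum f j (z ∷ xs) = trans (coeff-+P j (f z) _) (cong (λ s → coeff j (f z) ℤ.+ s) (coeff-polySum f j xs))

  coeff-weight : ∀ ms j → coeff j (weight ms) ≡
    (if (j ℕ.+ numNonTrivial ms ℕ.≡ᵇ length ms) then -1ℤ ^ numNonTrivial ms else 0ℤ)
  coeff-weight [] zero = refl
  coeff-weight [] (suc j) = refl
  coeff-weight (zero ∷ ms) zero = trans (coeff-X*P-zero (weight ms))
    (sym (cong (λ b → if b then -1ℤ ^ numNonTrivial ms else 0ℤ)
               (≡ᵇ-false (λ eq → ℕP.<-irrefl eq (ℕ.s≤s (numNonTrivial≤length ms))))))
  coeff-weight (zero ∷ ms) (suc j) = trans (coeff-X*P j (weight ms)) (coeff-weight ms j)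
  coeff-weight (suc m ∷ ms) j = begin
    coeff j (-1P *P weight ms)
      ≡⟨ coeff-constP*P j -1ℤ (weight ms) ⟩
    -1ℤ ℤ.* coeff j (weight ms)
      ≡⟨ cong (-1ℤ ℤ.*_) (coeff-weight ms j) ⟩
    -1ℤ ℤ.* (if (j ℕ.+ t ℕ.≡ᵇ length ms) then -1ℤ ^ t else 0ℤ)
      ≡⟨ negate (j ℕ.+ t ℕ.≡ᵇ length ms) ⟩
    (if (j ℕ.+ t ℕ.≡ᵇ length ms) then -1ℤ ^ suc t else 0ℤ)
      ≡⟨ cong (λ b → if b then -1ℤ ^ suc t else 0ℤ) (cong (ℕ._≡ᵇ suc (length ms)) (sym (ℕP.+-suc j t))) ⟩
    (if (j ℕ.+ suc t ℕ.≡ᵇ suc (length ms)) then -1ℤ ^ suc t else 0ℤ) ∎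
    where
    open ≡-Reasoning
    t = numNonTrivial ms
    negate : ∀ b → -1ℤ ℤ.* (if b then -1ℤ ^ t else 0ℤ) ≡ (if b then -1ℤ ^ suc t else 0ℤ)
    negate true = refl
    negate false = refl

  degree-test : ∀ n k t → k ≤ n → ((n ∸ k) ℕ.+ t ℕ.≡ᵇ n) ≡ (t ℕ.≡ᵇ k)
  degree-test n k t k≤n = ≡ᵇ-cong
    (λ eq → ℕP.+-cancelˡ-≡ (n ∸ k) t k (trans eq (sym (ℕP.m∸n+n≡m k≤n))))
    (λ eq → trans (cong ((n ∸ k) ℕ.+_) eq) (ℕP.m∸n+n≡m k≤n))

  coeff-collection : ∀ T k → k ≤ numLeaves T → ∀ ms → length ms ≡ numLeaves T →
    coeff (numLeaves T ∸ k) (if edgeDisjoint T ms then weight ms else []) ≡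
    (if edgeDisjoint T ms ∧ (numNonTrivial ms ℕ.≡ᵇ k) then -1ℤ ^ k else 0ℤ)
  coeff-collection T k k≤n ms len with edgeDisjoint T ms
  ... | false = refl
  ... | true = trans (coeff-weight ms (numLeaves T ∸ k))
    (trans (cong (λ b → if b then -1ℤ ^ numNonTrivial ms else 0ℤ)
                 (trans (cong ((numLeaves T ∸ k) ℕ.+ numNonTrivial ms ℕ.≡ᵇ_) len) (degree-test (numLeaves T) k (numNonTrivial ms) k≤n)))
           (exponent (numNonTrivial ms ℕ.≡ᵇ k) refl))
    where
    exponent : ∀ b → (numNonTrivial ms ℕ.≡ᵇ k) ≡ b → (if b then -1ℤ ^ numNonTrivial ms else 0ℤ) ≡ (if b then -1ℤ ^ k else 0ℤ)
    exponent true eq = cong (-1ℤ ^_) (≡ᵇ-sound {numNonTrivial ms} {k} eq)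
    exponent false _ = refl

  coeff-Γ : ∀ T k → k ≤ numLeaves T → coeff (numLeaves T ∸ k) (Γ T) ≡ (-1ℤ ^ k) ℤ.* + countK T k
  coeff-Γ T k k≤n = begin
    coeff j (Γ T)
      ≡⟨ coeff-≡ (Γ≈ T) j ⟩
    coeff j (polySum (map (λ ms → if edgeDisjoint T ms then weight ms else []) (collections T)))
      ≡⟨ coeff-polySum (λ ms → if edgeDisjoint T ms then weight ms else []) j (collections T) ⟩
    zsum (map (λ ms → coeff j (if edgeDisjoint T ms then weight ms else [])) (collections T))
      ≡⟨ cong zsum (LP.map-cong-local (All.map (coeff-collection T k k≤n _) (collectionsFor-length (leaves T)))) ⟩
    zsum (map (λ ms → if edgeDisjoint T ms ∧ (numNonTrivial ms ℕ.≡ᵇ k) then -1ℤ ^ k else 0ℤ) (collections T))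
      ≡⟨ count-indicator (λ ms → edgeDisjoint T ms ∧ (numNonTrivial ms ℕ.≡ᵇ k)) (-1ℤ ^ k) (collections T) ⟩
    (-1ℤ ^ k) ℤ.* + countK T k ∎
    where
    open ≡-Reasoning
    j = numLeaves T ∸ k

open import Defs
open import Data.Nat using (ℕ; _≤_)
open import Data.Integer using (+_; _*_; -1ℤ; _^_)
open import Data.Product using (_×_; _,_)
open import Relation.Binary.PropositionalEquality using (_≡_)

theorem3p2 : (T : RTree)
    → ((k : ℕ) → k ≤ numLeaves T
    → coeff (numLeaves T Data.Nat.∸ k) (Γ T) ≡ (-1ℤ ^ k) * + countK T k)
    × (DetZ.det (IplusC T) ≡ + countAll T)
theorem3p2 T = CharacteristicPolynomial.coeff-Γ T , IdentityPlusAncestral.det-I+C T
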